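{- Let $A$ be a formula of the language of $\mathrm{HA}^\omega_*$ with free variables $\underline{a}$, and let $T_{\not\exists}$ be a set of $\exists$-free formulas. If $$\mathrm{HA}^{\omega}_*+\mathrm{AC}^{\omega}_*+\mathrm{IP}^*_{\not\exists}+T_{\not\exists}\vdash A(\underline{a}),$$ then there exist closed terms $\underline{t}$ such that $$\mathrm{HA}^{\omega}_*+T_{\not\exists}\vdash A_{HR}(\underline{a},\underline{t}\underline{a}),$$ where $A^{HR}\equiv\exists\underline{x}\,A_{HR}(\underline{a},\underline{x})$.
   Context: Types are generated from the ground type $N$ by $\sigma\to\tau$ and $\sigma^*$. Constants: $0:N$, $S:N\to N$, $R_\sigma:N\to\sigma\to(\sigma\to N\to\sigma)\to\sigma$; $\Pi_{\sigma,\tau}:\sigma\to\tau\to\sigma$; $\Sigma_{\rho,\sigma,\tau}:(\rho\to\sigma\to\tau)\to(\rho\to\sigma)\to\rho\to\tau$; $\mathfrak{s}_\sigma:\sigma\to\sigma^*$; $\cup_\sigma:\sigma^*\to\sigma^*\to\sigma^*$; $\bigcup_{\sigma,\tau}:\sigma^*\to(\sigma\to\tau^*)\to\tau^*$. Terms: constants, typed variables, applications. Atomic formulas: $\bot$, $t=_\rho q$, $t\in_\rho q$ ($q:\rho^*$). Formulas: closed under $\lor,\land,\to,\forall x,\exists x$ and bounded quantifiers $\forall x\in t,\exists x\in t$ ($t:\rho^*$ not containing $x:\rho$). $\exists$-free: no unbounded $\exists x$. $\mathrm{IL}^{\omega}_*$ (in this language) is intuitionistic predicate logic in all finite types with: $x=x$;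 $x=y\land A\to A'$ ($A$ atomic, $A'$ replacing some $x$ by $y$); $\forall x\in t\,A\leftrightarrow\forall x(x\in t\to A)$; $\exists x\in t\,A\leftrightarrow\exists x(x\in t\land A)$; $\Sigma xyz=xz(yz)$; $\Pi xy=x$; $w\in\mathfrak{s}x\leftrightarrow w=x$; $w\in\cup xy\leftrightarrow w\in x\lor w\in y$; $z\in x\land w\in yz\to w\in\bigcup xy$; $\bigcup(\mathfrak{s}x)y=yx$; $\bigcup(\cup xy)z=\cup(\bigcup xz)(\bigcup yz)$. $\mathrm{HA}^\omega_*$ is $\mathrm{IL}^\omega_*$ plus the universal axioms for successor and recursor ($\neg(Sx=0)$, $Sx=Sy\to x=y$, $R0yz=y$, $R(Sx)yz=z(Rxyz)x$) and the full induction scheme $A(0)\land\forall n(A(n)\to A(Sn))\to\forall n\,A(n)$. $\mathrm{AC}^{\omega}_*$: $\forall x^\rho\exists y^\sigma A(x,y)\to\exists f^{\rho\to\sigma^*}\forall x\exists y\in fx\,A(x,y)$. $\mathrm{IP}^*_{\not\exists}$: $(B(x)\to\exists y\,A(y))\to\exists w(B(x)\to\exists y\in w\,A(y))$ for $\exists$-free $B$. The translation $A^{HR}\equiv\exists\underline{x}A_{HR}(\underline{x})$ ($A_{HR}$ $\exists$-free): atomic $A$: $A^{HR}:\equiv A_{HR}:\equiv A$; $(A\lor B)^{HR}:\equiv\exists\underline{x},\underline{u}(A_{HR}(\underline{x})\lor B_{HR}(\underline{u}))$; $(A\land B)^{HR}:\equiv\exists\underline{x},\underline{u}(A_{HR}(\underline{x})\land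 B_{HR}(\underline{u}))$; $(A\to B)^{HR}:\equiv\exists\underline{U}\forall\underline{x}(A_{HR}(\underline{x})\to B_{HR}(\underline{U}\underline{x}))$; $(\exists zA(z))^{HR}:\equiv\exists Z,\underline{x}\,\exists z\in Z\,A_{HR}(z,\underline{x})$; $(\forall zA(z))^{HR}:\equiv\exists\underline{X}\forall z\,A_{HR}(z,\underline{X}z)$; $(\exists z\in t\,A(z))^{HR}:\equiv\exists\underline{x}\exists z\in t\,A_{HR}(z,\underline{x})$; $(\forall z\in t\,A(z))^{HR}:\equiv\exists\underline{x}\forall z\in t\,A_{HR}(z,\underline{x})$, where $A^{HR}\equiv\exists\underline{x}A_{HR}(\underline{x})$ and $B^{HR}\equiv\exists\underline{u}B_{HR}(\underline{u})$. -}

module Defs where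

open import Data.List using (List; []; _∷_; _++_; map)
open import Data.List.Membership.Propositional using () renaming (_∈_ to _∈ᴸ_)
open import Data.Product using (_×_; _,_; proj₁; proj₂)

infixr 7 _⇒_
infix 8 _*

data Ty : Set where
  N   : Ty
  _⇒_ : Ty → Ty → Ty
  _*  : Ty → Ty

-- Contexts (de Bruijn; the head is the most recently bound variable)
Ctx : Set
Ctx = List Ty

infix 4 _∋_
data _∋_ : Ctx → Ty → Set where
  here  : ∀ {Γ τ} → (τ ∷ Γ) ∋ τ
  there : ∀ {Γ σ τ} → Γ ∋ τ → (σ ∷ Γ) ∋ τ

infixl 9 _·_

data Tm (Γ : Ctx) : Ty → Set where
  var  : ∀ {τ} → Γ ∋ τ → Tm Γ τ
  `0   : Tm Γ N
  `S   : Tm Γ (N ⇒ N)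
  `R   : ∀ σ → Tm Γ (N ⇒ σ ⇒ (σ ⇒ N ⇒ σ) ⇒ σ)
  `Π   : ∀ σ τ → Tm Γ (σ ⇒ τ ⇒ σ)
  `Σ   : ∀ ρ σ τ → Tm Γ ((ρ ⇒ σ ⇒ τ) ⇒ (ρ ⇒ σ) ⇒ ρ ⇒ τ)
  `s   : ∀ σ → Tm Γ (σ ⇒ σ *)
  `∪   : ∀ σ → Tm Γ (σ * ⇒ σ * ⇒ σ *)
  `⋃   : ∀ σ τ → Tm Γ (σ * ⇒ (σ ⇒ τ *) ⇒ τ *)
  _·_  : ∀ {σ τ} → Tm Γ (σ ⇒ τ) → Tm Γ σ → Tm Γ τ

-- Formulas.  Bounded quantifiers ∀x∈t, ∃x∈t bind x in A only, so t
-- cannot contain x (it lives in the outer context).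

infix  6 _≐_ _∈ᶠ_
infixr 5 _∧ᶠ_
infixr 4 _∨ᶠ_
infixr 3 _⇒ᶠ_

data Fm (Γ : Ctx) : Set where
  ⊥ᶠ    : Fm Γ
  _≐_   : ∀ {ρ} → Tm Γ ρ → Tm Γ ρ → Fm Γ
  _∈ᶠ_  : ∀ {ρ} → Tm Γ ρ → Tm Γ (ρ *) → Fm Γ
  _∨ᶠ_  : Fm Γ → Fm Γ → Fm Γ
  _∧ᶠ_  : Fm Γ → Fm Γ → Fm Γ
  _⇒ᶠ_  : Fm Γ → Fm Γ → Fm Γ
  ∀ᶠ    : ∀ ρ → Fm (ρ ∷ Γ) → Fm Γ
  ∃ᶠ    : ∀ ρ → Fm (ρ ∷ Γ) → Fm Γ
  ∀∈    : ∀ ρ → Tm Γ (ρ *) → Fm (ρ ∷ Γ) → Fm Γ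
  ∃∈    : ∀ ρ → Tm Γ (ρ *) → Fm (ρ ∷ Γ) → Fm Γ

infix 2 _⇔ᶠ_
_⇔ᶠ_ : ∀ {Γ} → Fm Γ → Fm Γ → Fm Γ
A ⇔ᶠ B = (A ⇒ᶠ B) ∧ᶠ (B ⇒ᶠ A)

¬ᶠ : ∀ {Γ} → Fm Γ → Fm Γ
¬ᶠ A = A ⇒ᶠ ⊥ᶠ

data Atomic {Γ : Ctx} : Fm Γ → Set where
  at-⊥ : Atomic ⊥ᶠ
  at-≐ : ∀ {ρ} (t q : Tm Γ ρ) → Atomic (t ≐ q)
  at-∈ : ∀ {ρ} (t : Tm Γ ρ) (q : Tm Γ (ρ *)) → Atomic (t ∈ᶠ q)

data ExFree {Γ : Ctx} : Fm Γ → Set where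
  ef-⊥ : ExFree ⊥ᶠ
  ef-≐ : ∀ {ρ} (t q : Tm Γ ρ) → ExFree (t ≐ q)
  ef-∈ : ∀ {ρ} (t : Tm Γ ρ) (q : Tm Γ (ρ *)) → ExFree (t ∈ᶠ q)
  ef-∨ : ∀ {A B} → ExFree A → ExFree B → ExFree (A ∨ᶠ B)
  ef-∧ : ∀ {A B} → ExFree A → ExFree B → ExFree (A ∧ᶠ B)
  ef-⇒ : ∀ {A B} → ExFree A → ExFree B → ExFree (A ⇒ᶠ B)
  ef-∀ : ∀ {ρ A} → ExFree A → ExFree (∀ᶠ ρ A)
  ef-∀∈ : ∀ {ρ t A} → ExFree A → ExFree (∀∈ ρ t A)
  ef-∃∈ : ∀ {ρ t A} → ExFree A → ExFree (∃∈ ρ t A)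

Ren : Ctx → Ctx → Set
Ren Γ Δ = ∀ {τ} → Γ ∋ τ → Δ ∋ τ

extR : ∀ {Γ Δ σ} → Ren Γ Δ → Ren (σ ∷ Γ) (σ ∷ Δ)
extR r here      = here
extR r (there v) = there (r v)

renT : ∀ {Γ Δ τ} → Ren Γ Δ → Tm Γ τ → Tm Δ τ
renT r (var v)     = var (r v)
renT r `0          = `0
renT r `S          = `S
renT r (`R σ)      = `R σ
renT r (`Π σ τ)    = `Π σ τ
renT r (`Σ ρ σ τ)  = `Σ ρ σ τ
renT r (`s σ)      = `s σ
renT r (`∪ σ)      = `∪ σ
renT r (`⋃ σ τ)    = `⋃ σ τ
renT r (t · u)     = renT r t · renT r u

renF : ∀ {Γ Δ} → Ren Γ Δ → Fm Γ → Fm Δ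
renF r ⊥ᶠ          = ⊥ᶠ
renF r (t ≐ q)     = renT r t ≐ renT r q
renF r (t ∈ᶠ q)    = renT r t ∈ᶠ renT r q
renF r (A ∨ᶠ B)    = renF r A ∨ᶠ renF r B
renF r (A ∧ᶠ B)    = renF r A ∧ᶠ renF r B
renF r (A ⇒ᶠ B)    = renF r A ⇒ᶠ renF r B
renF r (∀ᶠ ρ A)    = ∀ᶠ ρ (renF (extR r) A)
renF r (∃ᶠ ρ A)    = ∃ᶠ ρ (renF (extR r) A)
renF r (∀∈ ρ t A)  = ∀∈ ρ (renT r t) (renF (extR r) A)
renF r (∃∈ ρ t A)  = ∃∈ ρ (renT r t) (renF (extR r) A)

wkT : ∀ {Γ σ τ} → Tm Γ τ → Tm (σ ∷ Γ) τ
wkT = renT there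

wkF : ∀ {Γ σ} → Fm Γ → Fm (σ ∷ Γ)
wkF = renF there

Sub : Ctx → Ctx → Set
Sub Γ Δ = ∀ {τ} → Γ ∋ τ → Tm Δ τ

idS : ∀ {Γ} → Sub Γ Γ
idS = var

extS : ∀ {Γ Δ σ} → Sub Γ Δ → Sub (σ ∷ Γ) (σ ∷ Δ)
extS s here      = var here
extS s (there v) = wkT (s v)

subT : ∀ {Γ Δ τ} → Sub Γ Δ → Tm Γ τ → Tm Δ τ
subT s (var v)     = s v
subT s `0          = `0
subT s `S          = `S
subT s (`R σ)      = `R σ
subT s (`Π σ τ)    = `Π σ τ
subT s (`Σ ρ σ τ)  = `Σ ρ σ τ
subT s (`s σ)      = `s σ
subT s (`∪ σ)      = `∪ σ
subT s (`⋃ σ τ)    = `⋃ σ τ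
subT s (t · u)     = subT s t · subT s u

subF : ∀ {Γ Δ} → Sub Γ Δ → Fm Γ → Fm Δ
subF s ⊥ᶠ          = ⊥ᶠ
subF s (t ≐ q)     = subT s t ≐ subT s q
subF s (t ∈ᶠ q)    = subT s t ∈ᶠ subT s q
subF s (A ∨ᶠ B)    = subF s A ∨ᶠ subF s B
subF s (A ∧ᶠ B)    = subF s A ∧ᶠ subF s B
subF s (A ⇒ᶠ B)    = subF s A ⇒ᶠ subF s B
subF s (∀ᶠ ρ A)    = ∀ᶠ ρ (subF (extS s) A)
subF s (∃ᶠ ρ A)    = ∃ᶠ ρ (subF (extS s) A)
subF s (∀∈ ρ t A)  = ∀∈ ρ (subT s t) (subF (extS s) A)
subF s (∃∈ ρ t A)  = ∃∈ ρ (subT s t) (subF (extS s) A)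

sub0S : ∀ {Γ ρ} → Tm Γ ρ → Sub (ρ ∷ Γ) Γ
sub0S t here      = t
sub0S t (there v) = var v

_[_] : ∀ {Γ ρ} → Fm (ρ ∷ Γ) → Tm Γ ρ → Fm Γ
A [ t ] = subF (sub0S t) A

sucS : ∀ {Γ} → Sub (N ∷ Γ) (N ∷ Γ)
sucS here      = `S · var here
sucS (there v) = var (there v)

closeF : ∀ {Γ} → Fm [] → Fm Γ
closeF = renF (λ ())

Axioms : Set₁
Axioms = ∀ {Γ} → Fm Γ → Set

infix 1 _∣_⊢[_]_

data Der (Ax : Axioms) : (Γ : Ctx) → List (Fm Γ) → Fm Γ → Set

_∣_⊢[_]_ : (Γ : Ctx) → List (Fm Γ) → Axioms → Fm Γ → Set
Γ ∣ Δ ⊢[ Ax ] A = Der Ax Γ Δ A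

data Der Ax where
  hyp  : ∀ {Γ Δ A} → A ∈ᴸ Δ → Γ ∣ Δ ⊢[ Ax ] A
  ax   : ∀ {Γ Δ A} → Ax A → Γ ∣ Δ ⊢[ Ax ] A
  ⊥E   : ∀ {Γ Δ} A → Γ ∣ Δ ⊢[ Ax ] ⊥ᶠ → Γ ∣ Δ ⊢[ Ax ] A
  ∧I   : ∀ {Γ Δ A B} → Γ ∣ Δ ⊢[ Ax ] A → Γ ∣ Δ ⊢[ Ax ] B → Γ ∣ Δ ⊢[ Ax ] A ∧ᶠ B
  ∧E₁  : ∀ {Γ Δ A B} → Γ ∣ Δ ⊢[ Ax ] A ∧ᶠ B → Γ ∣ Δ ⊢[ Ax ] A
  ∧E₂  : ∀ {Γ Δ A B} → Γ ∣ Δ ⊢[ Ax ] A ∧ᶠ B → Γ ∣ Δ ⊢[ Ax ] B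
  ∨I₁  : ∀ {Γ Δ A} B → Γ ∣ Δ ⊢[ Ax ] A → Γ ∣ Δ ⊢[ Ax ] A ∨ᶠ B
  ∨I₂  : ∀ {Γ Δ B} A → Γ ∣ Δ ⊢[ Ax ] B → Γ ∣ Δ ⊢[ Ax ] A ∨ᶠ B
  ∨E   : ∀ {Γ Δ A B C} → Γ ∣ Δ ⊢[ Ax ] A ∨ᶠ B
       → Γ ∣ A ∷ Δ ⊢[ Ax ] C → Γ ∣ B ∷ Δ ⊢[ Ax ] C → Γ ∣ Δ ⊢[ Ax ] C
  ⇒I   : ∀ {Γ Δ A B} → Γ ∣ A ∷ Δ ⊢[ Ax ] B → Γ ∣ Δ ⊢[ Ax ] A ⇒ᶠ B
  ⇒E   : ∀ {Γ Δ A B} → Γ ∣ Δ ⊢[ Ax ] A ⇒ᶠ B → Γ ∣ Δ ⊢[ Ax ] A → Γ ∣ Δ ⊢[ Ax ] B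
  ∀I   : ∀ {Γ Δ ρ A} → (ρ ∷ Γ) ∣ map wkF Δ ⊢[ Ax ] A → Γ ∣ Δ ⊢[ Ax ] ∀ᶠ ρ A
  ∀E   : ∀ {Γ Δ ρ A} → Γ ∣ Δ ⊢[ Ax ] ∀ᶠ ρ A → (t : Tm Γ ρ) → Γ ∣ Δ ⊢[ Ax ] A [ t ]
  ∃I   : ∀ {Γ Δ ρ} A (t : Tm Γ ρ) → Γ ∣ Δ ⊢[ Ax ] A [ t ] → Γ ∣ Δ ⊢[ Ax ] ∃ᶠ ρ A
  ∃E   : ∀ {Γ Δ ρ A C} → Γ ∣ Δ ⊢[ Ax ] ∃ᶠ ρ A
       → (ρ ∷ Γ) ∣ A ∷ map wkF Δ ⊢[ Ax ] wkF C → Γ ∣ Δ ⊢[ Ax ] C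

-- Axioms of IL^ω_*  (schemata; term instances of the variable forms)

data ILAx : Axioms where
  eq-refl : ∀ {Γ ρ} (x : Tm Γ ρ) → ILAx (x ≐ x)
  eq-subst : ∀ {Γ ρ} (B : Fm (ρ ∷ Γ)) → Atomic B → (x y : Tm Γ ρ)
           → ILAx ((x ≐ y ∧ᶠ B [ x ]) ⇒ᶠ B [ y ])
  ball : ∀ {Γ ρ} (t : Tm Γ (ρ *)) (A : Fm (ρ ∷ Γ))
       → ILAx (∀∈ ρ t A ⇔ᶠ ∀ᶠ ρ (var here ∈ᶠ wkT t ⇒ᶠ A))
  bex  : ∀ {Γ ρ} (t : Tm Γ (ρ *)) (A : Fm (ρ ∷ Γ))
       → ILAx (∃∈ ρ t A ⇔ᶠ ∃ᶠ ρ (var here ∈ᶠ wkT t ∧ᶠ A))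
  Σ-ax : ∀ {Γ ρ σ τ} (x : Tm Γ (ρ ⇒ σ ⇒ τ)) (y : Tm Γ (ρ ⇒ σ)) (z : Tm Γ ρ)
       → ILAx (`Σ ρ σ τ · x · y · z ≐ x · z · (y · z))
  Π-ax : ∀ {Γ σ τ} (x : Tm Γ σ) (y : Tm Γ τ) → ILAx (`Π σ τ · x · y ≐ x)
  s-ax : ∀ {Γ σ} (w x : Tm Γ σ) → ILAx (w ∈ᶠ `s σ · x ⇔ᶠ w ≐ x)
  ∪-ax : ∀ {Γ σ} (w : Tm Γ σ) (x y : Tm Γ (σ *))
       → ILAx (w ∈ᶠ `∪ σ · x · y ⇔ᶠ (w ∈ᶠ x ∨ᶠ w ∈ᶠ y))
  ⋃-ax : ∀ {Γ σ τ} (z : Tm Γ σ) (x : Tm Γ (σ *)) (w : Tm Γ τ) (y : Tm Γ (σ ⇒ τ *))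
       → ILAx ((z ∈ᶠ x ∧ᶠ w ∈ᶠ y · z) ⇒ᶠ w ∈ᶠ `⋃ σ τ · x · y)
  ⋃s-ax : ∀ {Γ σ τ} (x : Tm Γ σ) (y : Tm Γ (σ ⇒ τ *))
        → ILAx (`⋃ σ τ · (`s σ · x) · y ≐ y · x)
  ⋃∪-ax : ∀ {Γ σ τ} (x y : Tm Γ (σ *)) (z : Tm Γ (σ ⇒ τ *))
        → ILAx (`⋃ σ τ · (`∪ σ · x · y) · z ≐ `∪ τ · (`⋃ σ τ · x · z) · (`⋃ σ τ · y · z))

data HAAx : Axioms where
  il    : ∀ {Γ} {A : Fm Γ} → ILAx A → HAAx A
  S≠0   : ∀ {Γ} (x : Tm Γ N) → HAAx (¬ᶠ (`S · x ≐ `0))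
  S-inj : ∀ {Γ} (x y : Tm Γ N) → HAAx (`S · x ≐ `S · y ⇒ᶠ x ≐ y)
  R0    : ∀ {Γ σ} (y : Tm Γ σ) (z : Tm Γ (σ ⇒ N ⇒ σ)) → HAAx (`R σ · `0 · y · z ≐ y)
  RS    : ∀ {Γ σ} (x : Tm Γ N) (y : Tm Γ σ) (z : Tm Γ (σ ⇒ N ⇒ σ))
        → HAAx (`R σ · (`S · x) · y · z ≐ z · (`R σ · x · y · z) · x)
  ind   : ∀ {Γ} (A : Fm (N ∷ Γ))
        → HAAx ((A [ `0 ] ∧ᶠ ∀ᶠ N (A ⇒ᶠ subF sucS A)) ⇒ᶠ ∀ᶠ N A)

-- AC^ω_* :  ∀x^ρ ∃y^σ A(x,y) → ∃f^{ρ→σ*} ∀x ∃y∈fx A(x,y)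
-- A lives in context (y : σ) ∷ (x : ρ) ∷ Γ.
acRen : ∀ {Γ ρ σ τ} → Ren (σ ∷ ρ ∷ Γ) (σ ∷ ρ ∷ τ ∷ Γ)
acRen here              = here
acRen (there here)      = there here
acRen (there (there v)) = there (there (there v))

AC : ∀ {Γ} ρ σ → Fm (σ ∷ ρ ∷ Γ) → Fm Γ
AC ρ σ A = ∀ᶠ ρ (∃ᶠ σ A)
         ⇒ᶠ ∃ᶠ (ρ ⇒ σ *) (∀ᶠ ρ (∃∈ σ (var (there here) · var here) (renF acRen A)))

ipRen : ∀ {Γ σ τ} → Ren (σ ∷ Γ) (σ ∷ τ ∷ Γ)
ipRen here      = here
ipRen (there v) = there (there v)

IP : ∀ {Γ} σ → Fm Γ → Fm (σ ∷ Γ) → Fm Γ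
IP σ B A = (B ⇒ᶠ ∃ᶠ σ A) ⇒ᶠ ∃ᶠ (σ *) (wkF B ⇒ᶠ ∃∈ σ (var here) (renF ipRen A))

data FullAx (T : Fm [] → Set) : Axioms where
  ha  : ∀ {Γ} {A : Fm Γ} → HAAx A → FullAx T A
  ac  : ∀ {Γ} ρ σ (A : Fm (σ ∷ ρ ∷ Γ)) → FullAx T (AC ρ σ A)
  ip  : ∀ {Γ} σ (B : Fm Γ) → ExFree B → (A : Fm (σ ∷ Γ)) → FullAx T (IP σ B A)
  thy : ∀ {Γ} (B : Fm []) → T B → FullAx T {Γ} (closeF B)

data HATAx (T : Fm [] → Set) : Axioms where
  ha  : ∀ {Γ} {A : Fm Γ} → HAAx A → HATAx T A
  thy : ∀ {Γ} (B : Fm []) → T B → HATAx T {Γ} (closeF B)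

infixr 5 _∷ₜ_
data Tms (Γ : Ctx) : List Ty → Set where
  []ₜ  : Tms Γ []
  _∷ₜ_ : ∀ {τ τs} → Tm Γ τ → Tms Γ τs → Tms Γ (τ ∷ τs)

renTms : ∀ {Γ Δ τs} → Ren Γ Δ → Tms Γ τs → Tms Δ τs
renTms r []ₜ       = []ₜ
renTms r (t ∷ₜ ts) = renT r t ∷ₜ renTms r ts

splitTms : ∀ {Γ} xs ys → Tms Γ (xs ++ ys) → Tms Γ xs × Tms Γ ys
splitTms []       ys ts        = []ₜ , ts
splitTms (x ∷ xs) ys (t ∷ₜ ts) = (t ∷ₜ proj₁ (splitTms xs ys ts)) , proj₂ (splitTms xs ys ts)

_⇛_ : List Ty → Ty → Ty
[]       ⇛ u = u
(w ∷ ws) ⇛ u = w ⇒ (ws ⇛ u)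

appTms : ∀ {Γ ws u} → Tm Γ (ws ⇛ u) → Tms Γ ws → Tm Γ u
appTms t []ₜ       = t
appTms t (s ∷ₜ ss) = appTms (t · s) ss

-- extending a context by a list of fresh variables w₁ … wₖ (wₖ innermost)
extCtx : Ctx → List Ty → Ctx
extCtx Γ []       = Γ
extCtx Γ (w ∷ ws) = extCtx (w ∷ Γ) ws

wk* : ∀ {Γ} ws → Ren Γ (extCtx Γ ws)
wk* []       v = v
wk* (w ∷ ws) v = wk* ws (there v)

vars* : ∀ {Γ} ws → Tms (extCtx Γ ws) ws
vars* []       = []ₜ
vars* (w ∷ ws) = var (wk* ws here) ∷ₜ vars* ws

∀* : ∀ {Γ} ws → Fm (extCtx Γ ws) → Fm Γ
∀* []       A = A
∀* (w ∷ ws) A = ∀ᶠ w (∀* ws A)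

-- the types of the tuple x in A^HR ≡ ∃x A_HR(x)
W : ∀ {Γ} → Fm Γ → List Ty
W ⊥ᶠ         = []
W (t ≐ q)    = []
W (t ∈ᶠ q)   = []
W (A ∨ᶠ B)   = W A ++ W B
W (A ∧ᶠ B)   = W A ++ W B
W (A ⇒ᶠ B)   = map (W A ⇛_) (W B)
W (∀ᶠ ρ A)   = map (ρ ⇒_) (W A)
W (∃ᶠ ρ A)   = ρ * ∷ W A
W (∀∈ ρ t A) = W A
W (∃∈ ρ t A) = W A

appAll : ∀ {Γ} ws us → Tms Γ (map (ws ⇛_) us) → Tms Γ ws → Tms Γ us
appAll ws []       []ₜ       xs = []ₜ
appAll ws (u ∷ us) (U ∷ₜ Us) xs = appTms U xs ∷ₜ appAll ws us Us xs

appVar0 : ∀ {Γ ρ} ws → Tms Γ (map (ρ ⇒_) ws) → Tms (ρ ∷ Γ) ws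
appVar0 []       []ₜ       = []ₜ
appVar0 (w ∷ ws) (X ∷ₜ Xs) = (wkT X · var here) ∷ₜ appVar0 ws Xs

-- HRs A σ x  =  (A_HR)σ (x) : A_HR with the free variables of A
-- substituted by σ and the witness variables by the tuple x.
HRs : ∀ {Γ Δ} (A : Fm Γ) → Sub Γ Δ → Tms Δ (W A) → Fm Δ
HRs ⊥ᶠ         σ xs = ⊥ᶠ
HRs (t ≐ q)    σ xs = subT σ t ≐ subT σ q
HRs (t ∈ᶠ q)   σ xs = subT σ t ∈ᶠ subT σ q
HRs (A ∨ᶠ B)   σ xs =
  HRs A σ (proj₁ (splitTms (W A) (W B) xs)) ∨ᶠ HRs B σ (proj₂ (splitTms (W A) (W B) xs))
HRs (A ∧ᶠ B)   σ xs =
  HRs A σ (proj₁ (splitTms (W A) (W B) xs)) ∧ᶠ HRs B σ (proj₂ (splitTms (W A) (W B) xs))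
HRs (A ⇒ᶠ B)   σ Us =
  ∀* (W A) (HRs A (λ v → renT (wk* (W A)) (σ v)) (vars* (W A))
         ⇒ᶠ HRs B (λ v → renT (wk* (W A)) (σ v))
                  (appAll (W A) (W B) (renTms (wk* (W A)) Us) (vars* (W A))))
HRs (∀ᶠ ρ A)   σ Xs = ∀ᶠ ρ (HRs A (extS σ) (appVar0 (W A) Xs))
HRs (∃ᶠ ρ A)   σ (Z ∷ₜ xs) = ∃∈ ρ Z (HRs A (extS σ) (renTms there xs))
HRs (∀∈ ρ t A) σ xs = ∀∈ ρ (subT σ t) (HRs A (extS σ) (renTms there xs))
HRs (∃∈ ρ t A) σ xs = ∃∈ ρ (subT σ t) (HRs A (extS σ) (renTms there xs))

HR : ∀ {Γ} (A : Fm Γ) → Tms Γ (W A) → Fm Γ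
HR A = HRs A idS

-- Γ ⇛ᶜ τ : the type of a closed term taking the variables of Γ
-- (outermost first) as arguments
_⇛ᶜ_ : Ctx → Ty → Ty
[]      ⇛ᶜ τ = τ
(σ ∷ Γ) ⇛ᶜ τ = Γ ⇛ᶜ (σ ⇒ τ)

appCtx : ∀ Γ {τ} → Tm [] (Γ ⇛ᶜ τ) → Tm Γ τ
appCtx []      t = t
appCtx (σ ∷ Γ) t = wkT (appCtx Γ t) · var here

appCtxs : ∀ Γ ws → Tms [] (map (Γ ⇛ᶜ_) ws) → Tms Γ ws
appCtxs Γ []       []ₜ       = []ₜ
appCtxs Γ (w ∷ ws) (t ∷ₜ ts) = appCtx Γ t ∷ₜ appCtxs Γ ws ts

-- Soundness of the Herbrand functional interpretation, by induction on the derivation: for every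
-- substitution σ and realizers of the hypotheses, a derivation of A yields terms x with
-- HA^ω_* + T ⊢ A_HR(σ, x). Existential witnesses are finite sets of candidates, and A_HR is monotone
-- under hereditary inclusion of these sets, so the two branches of ∨E are merged by a union and the
-- witnesses of ∃E, which depend on the chosen element, by a big union. ∃-free formulas are their own
-- interpretation, which disposes of T and of the premise of IP; AC is realized by the identity, and
-- induction by simultaneous primitive recursion. Abstracting the free variables gives closed terms.

module Submission where

open import Defs
open import Data.List using (List; []; _∷_; _++_; map)
open import Data.List.Membership.Propositional using () renaming (_∈_ to _∈ᴸ_)
open import Data.List.Properties using (∷-injectiveʳ)
open import Data.List.Membership.Propositional.Properties using (∈-map⁺)
open import Data.List.Relation.Binary.Subset.Propositional using (_⊆_)
open import Data.List.Relation.Binary.Subset.Propositional.Properties using (map⁺; ∷⁺ʳ)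
open import Data.List.Relation.Unary.Any using (here; there)
open import Data.Product using (Σ; _×_; _,_; proj₁; proj₂)
open import Data.Unit using (⊤; tt)
open import Relation.Binary.PropositionalEquality hiding ([_])


_≗ˢ_ : ∀ {Γ Δ} → Sub Γ Δ → Sub Γ Δ → Set
σ ≗ˢ τ = ∀ {ρ} (v : _ ∋ ρ) → σ v ≡ τ v

_⨾_ : ∀ {Γ Δ Θ} → Sub Γ Δ → Sub Δ Θ → Sub Γ Θ
(σ ⨾ τ) v = subT τ (σ v)

subT-cong : ∀ {Γ Δ τ} {σ σ' : Sub Γ Δ} → σ ≗ˢ σ' → (t : Tm Γ τ) → subT σ t ≡ subT σ' t
subT-cong e (var v) = e v
subT-cong e `0 = refl
subT-cong e `S = refl
subT-cong e (`R σ) = refl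
subT-cong e (`Π σ τ) = refl
subT-cong e (`Σ ρ σ τ) = refl
subT-cong e (`s σ) = refl
subT-cong e (`∪ σ) = refl
subT-cong e (`⋃ σ τ) = refl
subT-cong e (t · u) = cong₂ _·_ (subT-cong e t) (subT-cong e u)

subT-subT : ∀ {Γ Δ Θ τ} (σ : Sub Γ Δ) (θ : Sub Δ Θ) (t : Tm Γ τ) → subT θ (subT σ t) ≡ subT (σ ⨾ θ) t
subT-subT σ θ (var v) = refl
subT-subT σ θ `0 = refl
subT-subT σ θ `S = refl
subT-subT σ θ (`R _) = refl
subT-subT σ θ (`Π _ _) = refl
subT-subT σ θ (`Σ _ _ _) = refl
subT-subT σ θ (`s _) = refl
subT-subT σ θ (`∪ _) = refl
subT-subT σ θ (`⋃ _ _) = refl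
subT-subT σ θ (t · u) = cong₂ _·_ (subT-subT σ θ t) (subT-subT σ θ u)

renT-sub : ∀ {Γ Δ τ} (r : Ren Γ Δ) (t : Tm Γ τ) → renT r t ≡ subT (λ v → var (r v)) t
renT-sub r (var v) = refl
renT-sub r `0 = refl
renT-sub r `S = refl
renT-sub r (`R _) = refl
renT-sub r (`Π _ _) = refl
renT-sub r (`Σ _ _ _) = refl
renT-sub r (`s _) = refl
renT-sub r (`∪ _) = refl
renT-sub r (`⋃ _ _) = refl
renT-sub r (t · u) = cong₂ _·_ (renT-sub r t) (renT-sub r u)

subT-id : ∀ {Γ τ} (t : Tm Γ τ) → subT var t ≡ t
subT-id (var v) = refl
subT-id `0 = refl
subT-id `S = refl
subT-id (`R _) = refl
subT-id (`Π _ _) = refl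
subT-id (`Σ _ _ _) = refl
subT-id (`s _) = refl
subT-id (`∪ _) = refl
subT-id (`⋃ _ _) = refl
subT-id (t · u) = cong₂ _·_ (subT-id t) (subT-id u)

subT-renT : ∀ {Γ Δ Θ τ} (r : Ren Γ Δ) (θ : Sub Δ Θ) (t : Tm Γ τ) → subT θ (renT r t) ≡ subT (λ v → θ (r v)) t
subT-renT r θ t = trans (cong (subT θ) (renT-sub r t)) (subT-subT _ θ t)

renT-subT : ∀ {Γ Δ Θ τ} (σ : Sub Γ Δ) (r : Ren Δ Θ) (t : Tm Γ τ) → renT r (subT σ t) ≡ subT (λ v → renT r (σ v)) t
renT-subT σ r t = trans (renT-sub r (subT σ t)) (trans (subT-subT σ _ t) (subT-cong (λ v → sym (renT-sub r (σ v))) t))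

renT-renT : ∀ {Γ Δ Θ τ} (r : Ren Γ Δ) (r' : Ren Δ Θ) (t : Tm Γ τ) → renT r' (renT r t) ≡ renT (λ v → r' (r v)) t
renT-renT r r' t = trans (renT-sub r' (renT r t)) (trans (subT-renT r _ t) (sym (renT-sub _ t)))

renT-id : ∀ {Γ τ} (t : Tm Γ τ) → renT (λ v → v) t ≡ t
renT-id t = trans (renT-sub _ t) (subT-id t)

renT-cong : ∀ {Γ Δ τ} {r r' : Ren Γ Δ} → (∀ {ρ} (v : Γ ∋ ρ) → r v ≡ r' v) → (t : Tm Γ τ) → renT r t ≡ renT r' t
renT-cong e t = trans (renT-sub _ t) (trans (subT-cong (λ v → cong var (e v)) t) (sym (renT-sub _ t)))

sub0-wk : ∀ {Γ ρ τ} (u : Tm Γ ρ) (t : Tm Γ τ) → subT (sub0S u) (wkT t) ≡ t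
sub0-wk u t = trans (subT-renT there (sub0S u) t) (subT-id t)

extS-cong : ∀ {Γ Δ ρ} {σ σ' : Sub Γ Δ} → σ ≗ˢ σ' → extS {σ = ρ} σ ≗ˢ extS σ'
extS-cong e here = refl
extS-cong e (there v) = cong wkT (e v)

extS-comp : ∀ {Γ Δ Θ ρ} (σ : Sub Γ Δ) (θ : Sub Δ Θ) → (extS {σ = ρ} σ ⨾ extS θ) ≗ˢ extS (σ ⨾ θ)
extS-comp σ θ here = refl
extS-comp σ θ (there v) = trans (subT-renT there (extS θ) (σ v)) (sym (renT-subT θ there (σ v)))

extS-sub0-comm : ∀ {Γ Δ ρ} (σ : Sub Γ Δ) (t : Tm Γ ρ) → (extS σ ⨾ sub0S (subT σ t)) ≗ˢ (sub0S t ⨾ σ)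
extS-sub0-comm σ t here = refl
extS-sub0-comm σ t (there v) = sub0-wk (subT σ t) (σ v)

extS-sucS : ∀ {Γ Δ} (σ : Sub Γ Δ) → (sucS ⨾ extS σ) ≗ˢ (extS σ ⨾ sucS)
extS-sucS σ here = refl
extS-sucS σ (there v) = sym (trans (subT-renT there sucS (σ v)) (sym (renT-sub there (σ v))))

extR-ext : ∀ {Γ Δ ρ} (r : Ren Γ Δ) → (λ {τ} (v : (ρ ∷ Γ) ∋ τ) → var (extR r v)) ≗ˢ extS (λ v → var (r v))
extR-ext r here = refl
extR-ext r (there v) = refl

extS-id : ∀ {Γ ρ} → extS {Γ} {Γ} {ρ} var ≗ˢ var
extS-id here = refl
extS-id (there v) = refl

subF-cong : ∀ {Γ Δ} {σ σ' : Sub Γ Δ} → σ ≗ˢ σ' → (A : Fm Γ) → subF σ A ≡ subF σ' A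
subF-cong e ⊥ᶠ = refl
subF-cong e (t ≐ q) = cong₂ _≐_ (subT-cong e t) (subT-cong e q)
subF-cong e (t ∈ᶠ q) = cong₂ _∈ᶠ_ (subT-cong e t) (subT-cong e q)
subF-cong e (A ∨ᶠ B) = cong₂ _∨ᶠ_ (subF-cong e A) (subF-cong e B)
subF-cong e (A ∧ᶠ B) = cong₂ _∧ᶠ_ (subF-cong e A) (subF-cong e B)
subF-cong e (A ⇒ᶠ B) = cong₂ _⇒ᶠ_ (subF-cong e A) (subF-cong e B)
subF-cong e (∀ᶠ ρ A) = cong (∀ᶠ ρ) (subF-cong (extS-cong e) A)
subF-cong e (∃ᶠ ρ A) = cong (∃ᶠ ρ) (subF-cong (extS-cong e) A)
subF-cong e (∀∈ ρ t A) = cong₂ (∀∈ ρ) (subT-cong e t) (subF-cong (extS-cong e) A)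
subF-cong e (∃∈ ρ t A) = cong₂ (∃∈ ρ) (subT-cong e t) (subF-cong (extS-cong e) A)

subF-subF : ∀ {Γ Δ Θ} (σ : Sub Γ Δ) (θ : Sub Δ Θ) (A : Fm Γ) → subF θ (subF σ A) ≡ subF (σ ⨾ θ) A
subF-subF σ θ ⊥ᶠ = refl
subF-subF σ θ (t ≐ q) = cong₂ _≐_ (subT-subT σ θ t) (subT-subT σ θ q)
subF-subF σ θ (t ∈ᶠ q) = cong₂ _∈ᶠ_ (subT-subT σ θ t) (subT-subT σ θ q)
subF-subF σ θ (A ∨ᶠ B) = cong₂ _∨ᶠ_ (subF-subF σ θ A) (subF-subF σ θ B)
subF-subF σ θ (A ∧ᶠ B) = cong₂ _∧ᶠ_ (subF-subF σ θ A) (subF-subF σ θ B)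
subF-subF σ θ (A ⇒ᶠ B) = cong₂ _⇒ᶠ_ (subF-subF σ θ A) (subF-subF σ θ B)
subF-subF σ θ (∀ᶠ ρ A) = cong (∀ᶠ ρ) (trans (subF-subF (extS σ) (extS θ) A) (subF-cong (extS-comp σ θ) A))
subF-subF σ θ (∃ᶠ ρ A) = cong (∃ᶠ ρ) (trans (subF-subF (extS σ) (extS θ) A) (subF-cong (extS-comp σ θ) A))
subF-subF σ θ (∀∈ ρ t A) = cong₂ (∀∈ ρ) (subT-subT σ θ t) (trans (subF-subF (extS σ) (extS θ) A) (subF-cong (extS-comp σ θ) A))
subF-subF σ θ (∃∈ ρ t A) = cong₂ (∃∈ ρ) (subT-subT σ θ t) (trans (subF-subF (extS σ) (extS θ) A) (subF-cong (extS-comp σ θ) A))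

renF-sub : ∀ {Γ Δ} (r : Ren Γ Δ) (A : Fm Γ) → renF r A ≡ subF (λ v → var (r v)) A
renF-sub r ⊥ᶠ = refl
renF-sub r (t ≐ q) = cong₂ _≐_ (renT-sub r t) (renT-sub r q)
renF-sub r (t ∈ᶠ q) = cong₂ _∈ᶠ_ (renT-sub r t) (renT-sub r q)
renF-sub r (A ∨ᶠ B) = cong₂ _∨ᶠ_ (renF-sub r A) (renF-sub r B)
renF-sub r (A ∧ᶠ B) = cong₂ _∧ᶠ_ (renF-sub r A) (renF-sub r B)
renF-sub r (A ⇒ᶠ B) = cong₂ _⇒ᶠ_ (renF-sub r A) (renF-sub r B)
renF-sub r (∀ᶠ ρ A) = cong (∀ᶠ ρ) (trans (renF-sub (extR r) A) (subF-cong (extR-ext r) A))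
renF-sub r (∃ᶠ ρ A) = cong (∃ᶠ ρ) (trans (renF-sub (extR r) A) (subF-cong (extR-ext r) A))
renF-sub r (∀∈ ρ t A) = cong₂ (∀∈ ρ) (renT-sub r t) (trans (renF-sub (extR r) A) (subF-cong (extR-ext r) A))
renF-sub r (∃∈ ρ t A) = cong₂ (∃∈ ρ) (renT-sub r t) (trans (renF-sub (extR r) A) (subF-cong (extR-ext r) A))

subF-id : ∀ {Γ} (A : Fm Γ) → subF var A ≡ A
subF-id ⊥ᶠ = refl
subF-id (t ≐ q) = cong₂ _≐_ (subT-id t) (subT-id q)
subF-id (t ∈ᶠ q) = cong₂ _∈ᶠ_ (subT-id t) (subT-id q)
subF-id (A ∨ᶠ B) = cong₂ _∨ᶠ_ (subF-id A) (subF-id B)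
subF-id (A ∧ᶠ B) = cong₂ _∧ᶠ_ (subF-id A) (subF-id B)
subF-id (A ⇒ᶠ B) = cong₂ _⇒ᶠ_ (subF-id A) (subF-id B)
subF-id (∀ᶠ ρ A) = cong (∀ᶠ ρ) (trans (subF-cong extS-id A) (subF-id A))
subF-id (∃ᶠ ρ A) = cong (∃ᶠ ρ) (trans (subF-cong extS-id A) (subF-id A))
subF-id (∀∈ ρ t A) = cong₂ (∀∈ ρ) (subT-id t) (trans (subF-cong extS-id A) (subF-id A))
subF-id (∃∈ ρ t A) = cong₂ (∃∈ ρ) (subT-id t) (trans (subF-cong extS-id A) (subF-id A))

subF-renF : ∀ {Γ Δ Θ} (r : Ren Γ Δ) (θ : Sub Δ Θ) (A : Fm Γ) → subF θ (renF r A) ≡ subF (λ v → θ (r v)) A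
subF-renF r θ A = trans (cong (subF θ) (renF-sub r A)) (subF-subF _ θ A)

renF-subF : ∀ {Γ Δ Θ} (σ : Sub Γ Δ) (r : Ren Δ Θ) (A : Fm Γ) → renF r (subF σ A) ≡ subF (λ v → renT r (σ v)) A
renF-subF σ r A = trans (renF-sub r (subF σ A)) (trans (subF-subF σ _ A) (subF-cong (λ v → sym (renT-sub r (σ v))) A))

renF-renF : ∀ {Γ Δ Θ} (r : Ren Γ Δ) (r' : Ren Δ Θ) (A : Fm Γ) → renF r' (renF r A) ≡ renF (λ v → r' (r v)) A
renF-renF r r' A = trans (renF-sub r' (renF r A)) (trans (subF-renF r _ A) (sym (renF-sub _ A)))

subF-inst : ∀ {Γ Δ ρ} (σ : Sub Γ Δ) (A : Fm (ρ ∷ Γ)) (t : Tm Γ ρ) → subF σ (A [ t ]) ≡ (subF (extS σ) A) [ subT σ t ]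
subF-inst σ A t = trans (subF-subF (sub0S t) σ A)
  (sym (trans (subF-subF (extS σ) (sub0S (subT σ t)) A) (subF-cong (extS-sub0-comm σ t) A)))

subF-wkF : ∀ {Γ Δ ρ} (σ : Sub Γ Δ) (A : Fm Γ) → subF (extS {σ = ρ} σ) (wkF A) ≡ wkF (subF σ A)
subF-wkF σ A = trans (subF-renF there (extS σ) A) (sym (renF-subF σ there A))

subT-wkT : ∀ {Γ Δ ρ τ} (σ : Sub Γ Δ) (t : Tm Γ τ) → subT (extS {σ = ρ} σ) (wkT t) ≡ wkT (subT σ t)
subT-wkT σ t = trans (subT-renT there (extS σ) t) (sym (renT-subT σ there t))

subF-sucS : ∀ {Γ Δ} (σ : Sub Γ Δ) (A : Fm (N ∷ Γ)) → subF (extS σ) (subF sucS A) ≡ subF sucS (subF (extS σ) A)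
subF-sucS σ A = trans (subF-subF sucS (extS σ) A) (trans (subF-cong (extS-sucS σ) A) (sym (subF-subF (extS σ) sucS A)))

inst-var0 : ∀ {Γ ρ} (A : Fm (ρ ∷ Γ)) → (renF (extR there) A) [ var here ] ≡ A
inst-var0 A = trans (subF-renF (extR there) (sub0S (var here)) A) (trans (subF-cong e A) (subF-id A))
  where
  e : (λ {τ} (v : _ ∋ τ) → sub0S (var here) (extR there v)) ≗ˢ var
  e here = refl
  e (there v) = refl

renF-id : ∀ {Γ} (A : Fm Γ) → renF (λ v → v) A ≡ A
renF-id A = trans (renF-sub _ A) (subF-id A)

closeF-sub : ∀ {Γ Δ} (σ : Sub Γ Δ) (B : Fm []) → subF σ (closeF {Γ} B) ≡ closeF B
closeF-sub σ B = trans (subF-renF _ σ B) (trans (subF-cong (λ ()) B) (sym (renF-sub _ B)))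

atomic-sub : ∀ {Γ Δ} (σ : Sub Γ Δ) {B : Fm Γ} → Atomic B → Atomic (subF σ B)
atomic-sub σ at-⊥ = at-⊥
atomic-sub σ (at-≐ t q) = at-≐ _ _
atomic-sub σ (at-∈ t q) = at-∈ _ _

W-sub : ∀ {Γ Δ} (s : Sub Γ Δ) (A : Fm Γ) → W (subF s A) ≡ W A
W-sub s ⊥ᶠ = refl
W-sub s (t ≐ q) = refl
W-sub s (t ∈ᶠ q) = refl
W-sub s (A ∨ᶠ B) = cong₂ _++_ (W-sub s A) (W-sub s B)
W-sub s (A ∧ᶠ B) = cong₂ _++_ (W-sub s A) (W-sub s B)
W-sub s (A ⇒ᶠ B) = cong₂ (λ a b → map (a ⇛_) b) (W-sub s A) (W-sub s B)
W-sub s (∀ᶠ ρ A) = cong (map (ρ ⇒_)) (W-sub (extS s) A)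
W-sub s (∃ᶠ ρ A) = cong (ρ * ∷_) (W-sub (extS s) A)
W-sub s (∀∈ ρ t A) = W-sub (extS s) A
W-sub s (∃∈ ρ t A) = W-sub (extS s) A

W-ren : ∀ {Γ Δ} (r : Ren Γ Δ) (A : Fm Γ) → W (renF r A) ≡ W A
W-ren r A = trans (cong W (renF-sub r A)) (W-sub _ A)


subTms : ∀ {Γ Δ τs} → Sub Γ Δ → Tms Γ τs → Tms Δ τs
subTms s []ₜ = []ₜ
subTms s (t ∷ₜ ts) = subT s t ∷ₜ subTms s ts

renTms-sub : ∀ {Γ Δ τs} (r : Ren Γ Δ) (xs : Tms Γ τs) → renTms r xs ≡ subTms (λ v → var (r v)) xs
renTms-sub r []ₜ = refl
renTms-sub r (t ∷ₜ ts) = cong₂ _∷ₜ_ (renT-sub r t) (renTms-sub r ts)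

subTms-subTms : ∀ {Γ Δ Θ τs} (σ : Sub Γ Δ) (θ : Sub Δ Θ) (xs : Tms Γ τs) → subTms θ (subTms σ xs) ≡ subTms (σ ⨾ θ) xs
subTms-subTms σ θ []ₜ = refl
subTms-subTms σ θ (t ∷ₜ ts) = cong₂ _∷ₜ_ (subT-subT σ θ t) (subTms-subTms σ θ ts)

subTms-cong : ∀ {Γ Δ τs} {σ σ' : Sub Γ Δ} → σ ≗ˢ σ' → (xs : Tms Γ τs) → subTms σ xs ≡ subTms σ' xs
subTms-cong e []ₜ = refl
subTms-cong e (t ∷ₜ ts) = cong₂ _∷ₜ_ (subT-cong e t) (subTms-cong e ts)

subTms-id : ∀ {Γ τs} (xs : Tms Γ τs) → subTms var xs ≡ xs
subTms-id []ₜ = refl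
subTms-id (t ∷ₜ ts) = cong₂ _∷ₜ_ (subT-id t) (subTms-id ts)

renTms-id : ∀ {Γ τs} (xs : Tms Γ τs) → renTms (λ v → v) xs ≡ xs
renTms-id xs = trans (renTms-sub _ xs) (subTms-id xs)

subTms-renTms : ∀ {Γ Δ Θ τs} (r : Ren Γ Δ) (θ : Sub Δ Θ) (xs : Tms Γ τs) → subTms θ (renTms r xs) ≡ subTms (λ v → θ (r v)) xs
subTms-renTms r θ xs = trans (cong (subTms θ) (renTms-sub r xs)) (subTms-subTms _ θ xs)

renTms-subTms : ∀ {Γ Δ Θ τs} (σ : Sub Γ Δ) (r : Ren Δ Θ) (xs : Tms Γ τs) → renTms r (subTms σ xs) ≡ subTms (λ v → renT r (σ v)) xs
renTms-subTms σ r xs = trans (renTms-sub r (subTms σ xs)) (trans (subTms-subTms σ _ xs) (subTms-cong (λ v → sym (renT-sub r (σ v))) xs))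

renTms-renTms : ∀ {Γ Δ Θ τs} (r : Ren Γ Δ) (r' : Ren Δ Θ) (xs : Tms Γ τs) → renTms r' (renTms r xs) ≡ renTms (λ v → r' (r v)) xs
renTms-renTms r r' xs = trans (renTms-sub r' (renTms r xs)) (trans (subTms-renTms r _ xs) (sym (renTms-sub _ xs)))

splitTms-subTms : ∀ {Γ Δ} (θ : Sub Γ Δ) as bs (xs : Tms Γ (as ++ bs))
                → splitTms as bs (subTms θ xs) ≡ (subTms θ (proj₁ (splitTms as bs xs)) , subTms θ (proj₂ (splitTms as bs xs)))
splitTms-subTms θ [] bs xs = refl
splitTms-subTms θ (a ∷ as) bs (t ∷ₜ xs) rewrite splitTms-subTms θ as bs xs = refl

appTms-sub : ∀ {Γ Δ ws u} (θ : Sub Γ Δ) (t : Tm Γ (ws ⇛ u)) (xs : Tms Γ ws) → subT θ (appTms t xs) ≡ appTms (subT θ t) (subTms θ xs)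
appTms-sub θ t []ₜ = refl
appTms-sub θ t (x ∷ₜ xs) = appTms-sub θ (t · x) xs

appAll-sub : ∀ {Γ Δ} (θ : Sub Γ Δ) ws us (Us : Tms Γ (map (ws ⇛_) us)) (xs : Tms Γ ws)
           → subTms θ (appAll ws us Us xs) ≡ appAll ws us (subTms θ Us) (subTms θ xs)
appAll-sub θ ws [] []ₜ xs = refl
appAll-sub θ ws (u ∷ us) (U ∷ₜ Us) xs = cong₂ _∷ₜ_ (appTms-sub θ U xs) (appAll-sub θ ws us Us xs)

appVar0-sub : ∀ {Γ Δ ρ} (θ : Sub Γ Δ) ws (Xs : Tms Γ (map (ρ ⇒_) ws))
            → subTms (extS θ) (appVar0 ws Xs) ≡ appVar0 ws (subTms θ Xs)
appVar0-sub θ [] []ₜ = refl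
appVar0-sub θ (w ∷ ws) (X ∷ₜ Xs) = cong₂ _∷ₜ_ (cong (_· var here) (subT-wkT θ X)) (appVar0-sub θ ws Xs)

subTms-wk : ∀ {Γ Δ ρ τs} (θ : Sub Γ Δ) (xs : Tms Γ τs) → subTms (extS {σ = ρ} θ) (renTms there xs) ≡ renTms there (subTms θ xs)
subTms-wk θ xs = trans (subTms-renTms there (extS θ) xs) (sym (renTms-subTms θ there xs))

sub0-wkTms : ∀ {Γ ρ ws} (u : Tm Γ ρ) (xs : Tms Γ ws) → subTms (sub0S u) (renTms there xs) ≡ xs
sub0-wkTms u xs = trans (subTms-renTms there (sub0S u) xs) (trans (subTms-cong (λ v → refl) xs) (subTms-id xs))

infixr 5 _++ₜ_
_++ₜ_ : ∀ {Γ as bs} → Tms Γ as → Tms Γ bs → Tms Γ (as ++ bs)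
[]ₜ ++ₜ ys = ys
(x ∷ₜ xs) ++ₜ ys = x ∷ₜ (xs ++ₜ ys)

splitTms-++ₜ : ∀ {Γ} as bs (xs : Tms Γ as) (ys : Tms Γ bs) → splitTms as bs (xs ++ₜ ys) ≡ (xs , ys)
splitTms-++ₜ [] bs []ₜ ys = refl
splitTms-++ₜ (a ∷ as) bs (x ∷ₜ xs) ys rewrite splitTms-++ₜ as bs xs ys = refl

extS* : ∀ {Γ Δ} ws → Sub Γ Δ → Sub (extCtx Γ ws) (extCtx Δ ws)
extS* [] θ = θ
extS* (w ∷ ws) θ = extS* ws (extS θ)

sub-∀* : ∀ {Γ Δ} ws (θ : Sub Γ Δ) (φ : Fm (extCtx Γ ws)) → subF θ (∀* ws φ) ≡ ∀* ws (subF (extS* ws θ) φ)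
sub-∀* [] θ φ = refl
sub-∀* (w ∷ ws) θ φ = cong (∀ᶠ w) (sub-∀* ws (extS θ) φ)

extS*-wk : ∀ {Γ Δ} ws (θ : Sub Γ Δ) {τ} (v : Γ ∋ τ) → extS* ws θ (wk* ws v) ≡ renT (wk* ws) (θ v)
extS*-wk [] θ v = sym (renT-id (θ v))
extS*-wk (w ∷ ws) θ v = trans (extS*-wk ws (extS θ) (there v)) (renT-renT there (wk* ws) (θ v))

extS*-vars : ∀ {Γ Δ} ws (θ : Sub Γ Δ) → subTms (extS* ws θ) (vars* ws) ≡ vars* ws
extS*-vars [] θ = refl
extS*-vars (w ∷ ws) θ = cong₂ _∷ₜ_ (extS*-wk ws (extS θ) here) (extS*-vars ws (extS θ))

sub-wk*T : ∀ {Γ Δ} ws (θ : Sub Γ Δ) {τ} (t : Tm Γ τ) → subT (extS* ws θ) (renT (wk* ws) t) ≡ renT (wk* ws) (subT θ t)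
sub-wk*T ws θ t = trans (subT-renT (wk* ws) (extS* ws θ) t) (trans (subT-cong (extS*-wk ws θ) t) (sym (renT-subT θ (wk* ws) t)))

sub-wk*Tms : ∀ {Γ Δ} ws (θ : Sub Γ Δ) {τs} (xs : Tms Γ τs) → subTms (extS* ws θ) (renTms (wk* ws) xs) ≡ renTms (wk* ws) (subTms θ xs)
sub-wk*Tms ws θ []ₜ = refl
sub-wk*Tms ws θ (t ∷ₜ xs) = cong₂ _∷ₜ_ (sub-wk*T ws θ t) (sub-wk*Tms ws θ xs)

-- Equality of tuples whose type lists are only propositionally equal, such as W (subF σ A) and W A.
infixr 5 _∷ᵉ_
data TEq {Δ : Ctx} : ∀ {ws ws'} → Tms Δ ws → Tms Δ ws' → Set where
  []ᵉ : TEq []ₜ []ₜ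
  _∷ᵉ_ : ∀ {τ ws ws'} (t : Tm Δ τ) {xs : Tms Δ ws} {ys : Tms Δ ws'} → TEq xs ys → TEq (t ∷ₜ xs) (t ∷ₜ ys)

TEq-refl : ∀ {Δ ws} (xs : Tms Δ ws) → TEq xs xs
TEq-refl []ₜ = []ᵉ
TEq-refl (t ∷ₜ xs) = t ∷ᵉ TEq-refl xs

TEq-sym : ∀ {Δ ws ws'} {xs : Tms Δ ws} {ys : Tms Δ ws'} → TEq xs ys → TEq ys xs
TEq-sym []ᵉ = []ᵉ
TEq-sym (t ∷ᵉ e) = t ∷ᵉ TEq-sym e

TEq→≡ : ∀ {Δ ws} {xs ys : Tms Δ ws} → TEq xs ys → xs ≡ ys
TEq→≡ []ᵉ = refl
TEq→≡ (t ∷ᵉ e) = cong (t ∷ₜ_) (TEq→≡ e)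

≡→TEq : ∀ {Δ ws} {xs ys : Tms Δ ws} → xs ≡ ys → TEq xs ys
≡→TEq {xs = xs} refl = TEq-refl xs

castT : ∀ {Δ ws ws'} → ws ≡ ws' → Tms Δ ws' → Tms Δ ws
castT refl ys = ys

castT-TEq : ∀ {Δ ws ws'} (p : ws ≡ ws') (ys : Tms Δ ws') → TEq (castT p ys) ys
castT-TEq refl ys = TEq-refl ys

split-TEq : ∀ {Δ} as as' bs bs' → as ≡ as' → {xs : Tms Δ (as ++ bs)} {ys : Tms Δ (as' ++ bs')} → TEq xs ys
          → TEq (proj₁ (splitTms as bs xs)) (proj₁ (splitTms as' bs' ys)) × TEq (proj₂ (splitTms as bs xs)) (proj₂ (splitTms as' bs' ys))
split-TEq [] [] bs bs' p e = []ᵉ , e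
split-TEq (a ∷ as) (a' ∷ as') bs bs' p {t ∷ₜ xs} {.t ∷ₜ ys} (.t ∷ᵉ e) with split-TEq as as' bs bs' (∷-injectiveʳ p) e
... | e1 , e2 = (t ∷ᵉ e1) , e2

renTms-TEq : ∀ {Δ Θ ws ws'} (r : Ren Δ Θ) {xs : Tms Δ ws} {ys : Tms Δ ws'} → TEq xs ys → TEq (renTms r xs) (renTms r ys)
renTms-TEq r []ᵉ = []ᵉ
renTms-TEq r (t ∷ᵉ e) = renT r t ∷ᵉ renTms-TEq r e

appVar0-TEq : ∀ {Δ ρ} ws ws' → ws ≡ ws' → {Xs : Tms Δ (map (ρ ⇒_) ws)} {Ys : Tms Δ (map (ρ ⇒_) ws')} → TEq Xs Ys
            → TEq (appVar0 ws Xs) (appVar0 ws' Ys)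
appVar0-TEq ws .ws refl e rewrite TEq→≡ e = TEq-refl _

castCtx : ∀ {Δ ws ws'} → ws ≡ ws' → Ren (extCtx Δ ws) (extCtx Δ ws')
castCtx refl v = v

castCtx-wk* : ∀ {Δ ws ws'} (p : ws ≡ ws') {τ} (v : Δ ∋ τ) → castCtx p (wk* ws v) ≡ wk* ws' v
castCtx-wk* refl v = refl

∀*-castCtx : ∀ {Δ ws ws'} (p : ws ≡ ws') (φ : Fm (extCtx Δ ws)) → ∀* ws φ ≡ ∀* ws' (renF (castCtx p) φ)
∀*-castCtx refl φ = cong (∀* _) (sym (renF-id φ))

castCtx-vars* : ∀ {Δ} ws ws' (p : ws ≡ ws') → TEq (renTms (castCtx {Δ} p) (vars* ws)) (vars* ws')
castCtx-vars* ws .ws refl = ≡→TEq (renTms-id (vars* ws))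

castCtx-appAll : ∀ {Δ} ws ws' us us' (p : ws ≡ ws') → us ≡ us' → {Us : Tms Δ (map (ws ⇛_) us)} {Us' : Tms Δ (map (ws' ⇛_) us')}
               → TEq Us Us'
               → TEq (renTms (castCtx p) (appAll ws us (renTms (wk* ws) Us) (vars* ws))) (appAll ws' us' (renTms (wk* ws') Us') (vars* ws'))
castCtx-appAll ws .ws us .us refl refl e rewrite TEq→≡ e = ≡→TEq (renTms-id _)


HRs-cong : ∀ {Γ Δ} (A : Fm Γ) {σ σ' : Sub Γ Δ} → σ ≗ˢ σ' → (xs : Tms Δ (W A)) → HRs A σ xs ≡ HRs A σ' xs
HRs-cong ⊥ᶠ e xs = refl
HRs-cong (t ≐ q) e xs = cong₂ _≐_ (subT-cong e t) (subT-cong e q)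
HRs-cong (t ∈ᶠ q) e xs = cong₂ _∈ᶠ_ (subT-cong e t) (subT-cong e q)
HRs-cong (A ∨ᶠ B) e xs = cong₂ _∨ᶠ_ (HRs-cong A e _) (HRs-cong B e _)
HRs-cong (A ∧ᶠ B) e xs = cong₂ _∧ᶠ_ (HRs-cong A e _) (HRs-cong B e _)
HRs-cong (A ⇒ᶠ B) e xs = cong (∀* (W A)) (cong₂ _⇒ᶠ_ (HRs-cong A e' _) (HRs-cong B e' _))
  where e' = λ {τ} (v : _ ∋ τ) → cong (renT (wk* (W A))) (e v)
HRs-cong (∀ᶠ ρ A) e xs = cong (∀ᶠ ρ) (HRs-cong A (extS-cong e) _)
HRs-cong (∃ᶠ ρ A) e (Z ∷ₜ xs) = cong (∃∈ ρ Z) (HRs-cong A (extS-cong e) _)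
HRs-cong (∀∈ ρ t A) e xs = cong₂ (∀∈ ρ) (subT-cong e t) (HRs-cong A (extS-cong e) _)
HRs-cong (∃∈ ρ t A) e xs = cong₂ (∃∈ ρ) (subT-cong e t) (HRs-cong A (extS-cong e) _)

subF-HRs : ∀ {Γ Δ Θ} (A : Fm Γ) (σ : Sub Γ Δ) (θ : Sub Δ Θ) (xs : Tms Δ (W A))
         → subF θ (HRs A σ xs) ≡ HRs A (σ ⨾ θ) (subTms θ xs)
subF-HRs ⊥ᶠ σ θ xs = refl
subF-HRs (t ≐ q) σ θ xs = cong₂ _≐_ (subT-subT σ θ t) (subT-subT σ θ q)
subF-HRs (t ∈ᶠ q) σ θ xs = cong₂ _∈ᶠ_ (subT-subT σ θ t) (subT-subT σ θ q)
subF-HRs (A ∨ᶠ B) σ θ xs rewrite splitTms-subTms θ (W A) (W B) xs =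
  cong₂ _∨ᶠ_ (subF-HRs A σ θ _) (subF-HRs B σ θ _)
subF-HRs (A ∧ᶠ B) σ θ xs rewrite splitTms-subTms θ (W A) (W B) xs =
  cong₂ _∧ᶠ_ (subF-HRs A σ θ _) (subF-HRs B σ θ _)
subF-HRs (A ⇒ᶠ B) σ θ Us =
  trans (sub-∀* (W A) θ _) (cong (∀* (W A)) (cong₂ _⇒ᶠ_
    (trans (subF-HRs A _ (extS* (W A) θ) _)
       (trans (cong (HRs A _) (extS*-vars (W A) θ)) (HRs-cong A (λ v → sub-wk*T (W A) θ (σ v)) _)))
    (trans (subF-HRs B _ (extS* (W A) θ) _)
       (trans (cong (HRs B _) (trans (appAll-sub (extS* (W A) θ) (W A) (W B) _ _)
                 (cong₂ (appAll (W A) (W B)) (sub-wk*Tms (W A) θ Us) (extS*-vars (W A) θ))))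
              (HRs-cong B (λ v → sub-wk*T (W A) θ (σ v)) _)))))
subF-HRs (∀ᶠ ρ A) σ θ Xs = cong (∀ᶠ ρ)
  (trans (subF-HRs A (extS σ) (extS θ) _) (trans (cong (HRs A _) (appVar0-sub θ (W A) Xs)) (HRs-cong A (extS-comp σ θ) _)))
subF-HRs (∃ᶠ ρ A) σ θ (Z ∷ₜ xs) = cong (∃∈ ρ (subT θ Z))
  (trans (subF-HRs A (extS σ) (extS θ) _) (trans (cong (HRs A _) (subTms-wk θ xs)) (HRs-cong A (extS-comp σ θ) _)))
subF-HRs (∀∈ ρ t A) σ θ xs = cong₂ (∀∈ ρ) (subT-subT σ θ t)
  (trans (subF-HRs A (extS σ) (extS θ) _) (trans (cong (HRs A _) (subTms-wk θ xs)) (HRs-cong A (extS-comp σ θ) _)))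
subF-HRs (∃∈ ρ t A) σ θ xs = cong₂ (∃∈ ρ) (subT-subT σ θ t)
  (trans (subF-HRs A (extS σ) (extS θ) _) (trans (cong (HRs A _) (subTms-wk θ xs)) (HRs-cong A (extS-comp σ θ) _)))

renF-HRs : ∀ {Γ Δ Θ} (A : Fm Γ) (σ : Sub Γ Δ) (r : Ren Δ Θ) (xs : Tms Δ (W A))
         → renF r (HRs A σ xs) ≡ HRs A (λ v → renT r (σ v)) (renTms r xs)
renF-HRs A σ r xs = trans (renF-sub r _) (trans (subF-HRs A σ _ xs)
  (trans (cong (HRs A _) (sym (renTms-sub r xs))) (HRs-cong A (λ v → sym (renT-sub r (σ v))) _)))

HRs-subF : ∀ {Γ Γ₁ Δ} (s : Sub Γ Γ₁) (A : Fm Γ) (σ : Sub Γ₁ Δ) (xs : Tms Δ (W (subF s A))) (ys : Tms Δ (W A))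
         → TEq xs ys → HRs (subF s A) σ xs ≡ HRs A (s ⨾ σ) ys
HRs-subF s ⊥ᶠ σ xs ys e = refl
HRs-subF s (t ≐ q) σ xs ys e = cong₂ _≐_ (subT-subT s σ t) (subT-subT s σ q)
HRs-subF s (t ∈ᶠ q) σ xs ys e = cong₂ _∈ᶠ_ (subT-subT s σ t) (subT-subT s σ q)
HRs-subF s (A ∨ᶠ B) σ xs ys e with split-TEq (W (subF s A)) (W A) (W (subF s B)) (W B) (W-sub s A) e
... | e1 , e2 = cong₂ _∨ᶠ_ (HRs-subF s A σ _ _ e1) (HRs-subF s B σ _ _ e2)
HRs-subF s (A ∧ᶠ B) σ xs ys e with split-TEq (W (subF s A)) (W A) (W (subF s B)) (W B) (W-sub s A) e
... | e1 , e2 = cong₂ _∧ᶠ_ (HRs-subF s A σ _ _ e1) (HRs-subF s B σ _ _ e2)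
HRs-subF s (A ⇒ᶠ B) σ Us Us' e =
  trans (∀*-castCtx p _) (cong (∀* (W A)) (cong₂ _⇒ᶠ_
    (trans (renF-HRs (subF s A) _ (castCtx p) _)
      (trans (HRs-subF s A _ _ _ (castCtx-vars* (W (subF s A)) (W A) p))
        (HRs-cong A (λ v → trans (subT-cong ew (s v)) (sym (renT-subT σ (wk* (W A)) (s v)))) _)))
    (trans (renF-HRs (subF s B) _ (castCtx p) _)
      (trans (HRs-subF s B _ _ _ (castCtx-appAll (W (subF s A)) (W A) (W (subF s B)) (W B) p (W-sub s B) e))
        (HRs-cong B (λ v → trans (subT-cong ew (s v)) (sym (renT-subT σ (wk* (W A)) (s v)))) _)))))
  where
  p = W-sub s A
  ew : ∀ {τ} (u : _ ∋ τ) → renT (castCtx p) (renT (wk* (W (subF s A))) (σ u)) ≡ renT (wk* (W A)) (σ u)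
  ew u = trans (renT-renT _ _ (σ u)) (renT-cong (castCtx-wk* p) (σ u))
HRs-subF s (∀ᶠ ρ A) σ Xs Ys e = cong (∀ᶠ ρ)
  (trans (HRs-subF (extS s) A (extS σ) _ _ (appVar0-TEq _ _ (W-sub (extS s) A) e)) (HRs-cong A (extS-comp s σ) _))
HRs-subF s (∃ᶠ ρ A) σ (Z ∷ₜ xs) (.Z ∷ₜ ys) (.Z ∷ᵉ e) = cong (∃∈ ρ Z)
  (trans (HRs-subF (extS s) A (extS σ) _ _ (renTms-TEq there e)) (HRs-cong A (extS-comp s σ) _))
HRs-subF s (∀∈ ρ t A) σ xs ys e = cong₂ (∀∈ ρ) (subT-subT s σ t)
  (trans (HRs-subF (extS s) A (extS σ) _ _ (renTms-TEq there e)) (HRs-cong A (extS-comp s σ) _))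
HRs-subF s (∃∈ ρ t A) σ xs ys e = cong₂ (∃∈ ρ) (subT-subT s σ t)
  (trans (HRs-subF (extS s) A (extS σ) _ _ (renTms-TEq there e)) (HRs-cong A (extS-comp s σ) _))

HRs-renF : ∀ {Γ Γ₁ Δ} (r : Ren Γ Γ₁) (A : Fm Γ) (σ : Sub Γ₁ Δ) (xs : Tms Δ (W (renF r A))) (ys : Tms Δ (W A))
         → TEq xs ys → HRs (renF r A) σ xs ≡ HRs A (λ v → σ (r v)) ys
HRs-renF r A σ = subst (λ B → (xs : Tms _ (W B)) (ys : Tms _ (W A)) → TEq xs ys → HRs B σ xs ≡ HRs A (λ v → σ (r v)) ys)
  (sym (renF-sub r A)) (HRs-subF (λ v → var (r v)) A σ)


weakD : ∀ {Ax : Axioms} {Γ Δ Δ' A} → Δ ⊆ Δ' → Der Ax Γ Δ A → Der Ax Γ Δ' A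
weakD s (hyp x) = hyp (s x)
weakD s (ax x) = ax x
weakD s (⊥E A d) = ⊥E A (weakD s d)
weakD s (∧I d d₁) = ∧I (weakD s d) (weakD s d₁)
weakD s (∧E₁ d) = ∧E₁ (weakD s d)
weakD s (∧E₂ d) = ∧E₂ (weakD s d)
weakD s (∨I₁ B d) = ∨I₁ B (weakD s d)
weakD s (∨I₂ A d) = ∨I₂ A (weakD s d)
weakD s (∨E d d₁ d₂) = ∨E (weakD s d) (weakD (∷⁺ʳ _ s) d₁) (weakD (∷⁺ʳ _ s) d₂)
weakD s (⇒I d) = ⇒I (weakD (∷⁺ʳ _ s) d)
weakD s (⇒E d d₁) = ⇒E (weakD s d) (weakD s d₁)
weakD s (∀I d) = ∀I (weakD (map⁺ wkF s) d)
weakD s (∀E d t) = ∀E (weakD s d) t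
weakD s (∃I A t d) = ∃I A t (weakD s d)
weakD s (∃E d d₁) = ∃E (weakD s d) (weakD (∷⁺ʳ _ (map⁺ wkF s)) d₁)

wk1 : ∀ {Ax : Axioms} {Γ Δ A B} → Der Ax Γ Δ A → Der Ax Γ (B ∷ Δ) A
wk1 = weakD there

map-subF-wkF : ∀ {Γ Γ' ρ} (s : Sub Γ Γ') (Δ : List (Fm Γ)) → map (subF (extS {σ = ρ} s)) (map wkF Δ) ≡ map wkF (map (subF s) Δ)
map-subF-wkF s [] = refl
map-subF-wkF s (A ∷ Δ) = cong₂ _∷_ (subF-wkF s A) (map-subF-wkF s Δ)

AxSubClosed : Axioms → Set
AxSubClosed Ax = ∀ {Γ Γ'} (s : Sub Γ Γ') {A : Fm Γ} → Ax A → Ax (subF s A)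

subD : ∀ {Ax : Axioms} → AxSubClosed Ax → ∀ {Γ Γ' Δ A} (s : Sub Γ Γ') → Der Ax Γ Δ A → Der Ax Γ' (map (subF s) Δ) (subF s A)
subD cl s (hyp x) = hyp (∈-map⁺ _ x)
subD cl s (ax x) = ax (cl s x)
subD cl s (⊥E A d) = ⊥E _ (subD cl s d)
subD cl s (∧I d d₁) = ∧I (subD cl s d) (subD cl s d₁)
subD cl s (∧E₁ d) = ∧E₁ (subD cl s d)
subD cl s (∧E₂ d) = ∧E₂ (subD cl s d)
subD cl s (∨I₁ B d) = ∨I₁ _ (subD cl s d)
subD cl s (∨I₂ A d) = ∨I₂ _ (subD cl s d)
subD cl s (∨E d d₁ d₂) = ∨E (subD cl s d) (subD cl s d₁) (subD cl s d₂)
subD cl s (⇒I d) = ⇒I (subD cl s d)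
subD cl s (⇒E d d₁) = ⇒E (subD cl s d) (subD cl s d₁)
subD cl {Δ = Δ} s (∀I d) = ∀I (subst (λ L → Der _ _ L _) (map-subF-wkF s Δ) (subD cl (extS s) d))
subD cl s (∀E {A = A} d t) = subst (Der _ _ _) (sym (subF-inst s A t)) (∀E (subD cl s d) (subT s t))
subD cl s (∃I A t d) = ∃I _ (subT s t) (subst (Der _ _ _) (subF-inst s A t) (subD cl s d))
subD cl {Δ = Δ} s (∃E {A = A} {C = C} d d₁) =
  ∃E (subD cl s d) (subst₂ (λ L F → Der _ _ (subF (extS s) A ∷ L) F) (map-subF-wkF s Δ) (subF-wkF s C) (subD cl (extS s) d₁))

map-renF-sub : ∀ {Γ Γ'} (r : Ren Γ Γ') (Δ : List (Fm Γ)) → map (subF (λ v → var (r v))) Δ ≡ map (renF r) Δ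
map-renF-sub r [] = refl
map-renF-sub r (A ∷ Δ) = cong₂ _∷_ (sym (renF-sub r A)) (map-renF-sub r Δ)

renD : ∀ {Ax : Axioms} → AxSubClosed Ax → ∀ {Γ Γ' Δ A} (r : Ren Γ Γ') → Der Ax Γ Δ A → Der Ax Γ' (map (renF r) Δ) (renF r A)
renD cl {Δ = Δ} {A} r d = subst₂ (Der _ _) (map-renF-sub r Δ) (sym (renF-sub r A)) (subD cl (λ v → var (r v)) d)

wkD : ∀ {Ax : Axioms} → AxSubClosed Ax → ∀ {Γ Δ A ρ} → Der Ax Γ Δ A → Der Ax (ρ ∷ Γ) (map wkF Δ) (wkF A)
wkD cl = renD cl there

HAAx-sub : ∀ {Γ Γ'} (s : Sub Γ Γ') {A : Fm Γ} → HAAx A → HAAx (subF s A)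
HAAx-sub s (il (eq-refl x)) = il (eq-refl _)
HAAx-sub s (il (eq-subst B at x y)) rewrite subF-inst s B x | subF-inst s B y = il (eq-subst _ (atomic-sub (extS s) at) _ _)
HAAx-sub s (il (ball {ρ = ρ} t A)) rewrite subT-wkT {ρ = ρ} s t = il (ball _ _)
HAAx-sub s (il (bex {ρ = ρ} t A)) rewrite subT-wkT {ρ = ρ} s t = il (bex _ _)
HAAx-sub s (il (Σ-ax x y z)) = il (Σ-ax _ _ _)
HAAx-sub s (il (Π-ax x y)) = il (Π-ax _ _)
HAAx-sub s (il (s-ax w x)) = il (s-ax _ _)
HAAx-sub s (il (∪-ax w x y)) = il (∪-ax _ _ _)
HAAx-sub s (il (⋃-ax z x w y)) = il (⋃-ax _ _ _ _)
HAAx-sub s (il (⋃s-ax x y)) = il (⋃s-ax _ _)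
HAAx-sub s (il (⋃∪-ax x y z)) = il (⋃∪-ax _ _ _)
HAAx-sub s (S≠0 x) = S≠0 _
HAAx-sub s (S-inj x y) = S-inj _ _
HAAx-sub s (R0 y z) = R0 _ _
HAAx-sub s (RS x y z) = RS _ _ _
HAAx-sub s (ind A) rewrite subF-inst s A `0 | subF-sucS s A = ind _

HATAx-sub : ∀ {T} → AxSubClosed (HATAx T)
HATAx-sub s (ha x) = ha (HAAx-sub s x)
HATAx-sub s (thy B x) rewrite closeF-sub s B = thy B x

_,ˢ_ : ∀ {Γ Δ ρ} → Sub Γ Δ → Tm Δ ρ → Sub (ρ ∷ Γ) Δ
(σ ,ˢ t) here = t
(σ ,ˢ t) (there v) = σ v

subT-,ˢ-wkT : ∀ {Γ Δ ρ τ} (σ : Sub Γ Δ) (t : Tm Δ ρ) (x : Tm Γ τ) → subT (σ ,ˢ t) (wkT x) ≡ subT σ x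
subT-,ˢ-wkT σ t x = trans (subT-renT there _ x) (subT-cong (λ v → refl) x)

appendS : ∀ {Γ Δ} ws → Sub Γ Δ → Tms Δ ws → Sub (extCtx Γ ws) Δ
appendS [] σ []ₜ = σ
appendS (w ∷ ws) σ (x ∷ₜ xs) = appendS ws (σ ,ˢ x) xs

appendS-wk* : ∀ {Γ Δ} ws (σ : Sub Γ Δ) (xs : Tms Δ ws) {τ} (v : Γ ∋ τ) → appendS ws σ xs (wk* ws v) ≡ σ v
appendS-wk* [] σ []ₜ v = refl
appendS-wk* (w ∷ ws) σ (x ∷ₜ xs) v = appendS-wk* ws (σ ,ˢ x) xs (there v)

appendS-vars* : ∀ {Γ Δ} ws (σ : Sub Γ Δ) (xs : Tms Δ ws) → subTms (appendS ws σ xs) (vars* ws) ≡ xs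
appendS-vars* [] σ []ₜ = refl
appendS-vars* (w ∷ ws) σ (x ∷ₜ xs) = cong₂ _∷ₜ_ (appendS-wk* ws (σ ,ˢ x) xs here) (appendS-vars* ws (σ ,ˢ x) xs)

extS-sub0-,ˢ : ∀ {Γ Δ ρ} (σ : Sub Γ Δ) (x : Tm Δ ρ) → (extS σ ⨾ sub0S x) ≗ˢ (σ ,ˢ x)
extS-sub0-,ˢ σ x here = refl
extS-sub0-,ˢ σ x (there v) = sub0-wk x (σ v)

appendS-cong : ∀ {Γ Δ} ws {σ σ' : Sub Γ Δ} (xs : Tms Δ ws) → σ ≗ˢ σ' → appendS ws σ xs ≗ˢ appendS ws σ' xs
appendS-cong [] []ₜ e = e
appendS-cong (w ∷ ws) (x ∷ₜ xs) e = appendS-cong ws xs e'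
  where
  e' : (_ ,ˢ x) ≗ˢ (_ ,ˢ x)
  e' here = refl
  e' (there v) = e v

appendS-id : ∀ {Γ} ws → appendS {Γ} ws (λ v → var (wk* ws v)) (vars* ws) ≗ˢ var
appendS-id [] v = refl
appendS-id {Γ} (w ∷ ws) v = trans (appendS-cong ws (vars* ws) e v) (appendS-id {w ∷ Γ} ws v)
  where
  e : ((λ {τ} (u : Γ ∋ τ) → var (wk* ws (there u))) ,ˢ var (wk* ws here)) ≗ˢ (λ u → var (wk* ws u))
  e here = refl
  e (there u) = refl

map-renF-id : ∀ {Γ} (H : List (Fm Γ)) → map (renF (λ v → v)) H ≡ H
map-renF-id [] = refl
map-renF-id (A ∷ H) = cong₂ _∷_ (renF-id A) (map-renF-id H)

map-renF-renF : ∀ {Γ Δ Θ} (r : Ren Γ Δ) (r' : Ren Δ Θ) (H : List (Fm Γ)) → map (renF r') (map (renF r) H) ≡ map (renF (λ v → r' (r v))) H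
map-renF-renF r r' [] = refl
map-renF-renF r r' (A ∷ H) = cong₂ _∷_ (renF-renF r r' A) (map-renF-renF r r' H)


module Derivable (T : Fm [] → Set) where

  infix 1 _⊢_
  _⊢_ : ∀ {Γ} → List (Fm Γ) → Fm Γ → Set
  Δ ⊢ A = Der (HATAx T) _ Δ A

  cast⊢ : ∀ {Γ} {Δ : List (Fm Γ)} {A B} → A ≡ B → Δ ⊢ A → Δ ⊢ B
  cast⊢ refl d = d

  castH : ∀ {Γ} {Δ Δ' : List (Fm Γ)} {A} → Δ ≡ Δ' → Δ ⊢ A → Δ' ⊢ A
  castH refl d = d

  wkH : ∀ {Γ Δ A ρ} → Δ ⊢ A → map wkF Δ ⊢ wkF {Γ} {ρ} A
  wkH = wkD HATAx-sub

  renH : ∀ {Γ Γ' Δ A} (r : Ren Γ Γ') → Δ ⊢ A → map (renF r) Δ ⊢ renF r A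
  renH = renD HATAx-sub

  ilax : ∀ {Γ} {Δ : List (Fm Γ)} {A} → ILAx A → Δ ⊢ A
  ilax a = ax (ha (il a))

  haax : ∀ {Γ} {Δ : List (Fm Γ)} {A} → HAAx A → Δ ⊢ A
  haax a = ax (ha a)

  iff→ : ∀ {Γ} {Δ : List (Fm Γ)} {A B} → Δ ⊢ (A ⇔ᶠ B) → Δ ⊢ A → Δ ⊢ B
  iff→ e d = ⇒E (∧E₁ e) d

  iff← : ∀ {Γ} {Δ : List (Fm Γ)} {A B} → Δ ⊢ (A ⇔ᶠ B) → Δ ⊢ B → Δ ⊢ A
  iff← e d = ⇒E (∧E₂ e) d

  ≐refl : ∀ {Γ} {Δ : List (Fm Γ)} {ρ} (t : Tm Γ ρ) → Δ ⊢ t ≐ t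
  ≐refl t = ilax (eq-refl t)

  ≐-subst : ∀ {Γ} {Δ : List (Fm Γ)} {ρ} (B : Fm (ρ ∷ Γ)) → Atomic B → {x y : Tm Γ ρ} → Δ ⊢ x ≐ y → Δ ⊢ B [ x ] → Δ ⊢ B [ y ]
  ≐-subst B at {x} {y} e d = ⇒E (ilax (eq-subst B at x y)) (∧I e d)

  ≐-cong : ∀ {Γ} {Δ : List (Fm Γ)} {ρ τ} (C : Tm (ρ ∷ Γ) τ) {x y : Tm Γ ρ} → Δ ⊢ x ≐ y → Δ ⊢ subT (sub0S x) C ≐ subT (sub0S y) C
  ≐-cong C {x} {y} e = subst (λ z → _ ⊢ z ≐ subT (sub0S y) C) (sub0-wk y (subT (sub0S x) C))
    (≐-subst (wkT (subT (sub0S x) C) ≐ C) (at-≐ _ _) e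
      (subst (λ z → _ ⊢ z ≐ subT (sub0S x) C) (sym (sub0-wk x (subT (sub0S x) C))) (≐refl _)))

  ≐sym : ∀ {Γ} {Δ : List (Fm Γ)} {ρ} {x y : Tm Γ ρ} → Δ ⊢ x ≐ y → Δ ⊢ y ≐ x
  ≐sym {x = x} {y} e = subst (λ z → _ ⊢ y ≐ z) (sub0-wk y x)
    (≐-subst (var here ≐ wkT x) (at-≐ _ _) e (subst (λ z → _ ⊢ x ≐ z) (sym (sub0-wk x x)) (≐refl x)))

  ≐trans : ∀ {Γ} {Δ : List (Fm Γ)} {ρ} {x y z : Tm Γ ρ} → Δ ⊢ x ≐ y → Δ ⊢ y ≐ z → Δ ⊢ x ≐ z
  ≐trans {x = x} {y} {z} e f = subst (λ w → _ ⊢ w ≐ z) (sub0-wk z x)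
    (≐-subst (wkT x ≐ var here) (at-≐ _ _) f (subst (λ w → _ ⊢ w ≐ y) (sym (sub0-wk y x)) e))

  ·-cong : ∀ {Γ} {Δ : List (Fm Γ)} {σ τ} {f g : Tm Γ (σ ⇒ τ)} {a b : Tm Γ σ} → Δ ⊢ f ≐ g → Δ ⊢ a ≐ b → Δ ⊢ f · a ≐ g · b
  ·-cong {f = f} {g} {a} {b} e1 e2 = ≐trans
    (subst₂ (λ u w → _ ⊢ f · u ≐ g · w) (sub0-wk f a) (sub0-wk g a) (≐-cong (var here · wkT a) e1))
    (subst₂ (λ u w → _ ⊢ u · a ≐ w · b) (sub0-wk a g) (sub0-wk b g) (≐-cong (wkT g · var here) e2))

  ∈-congL : ∀ {Γ} {Δ : List (Fm Γ)} {ρ} {x y : Tm Γ ρ} {t} → Δ ⊢ x ≐ y → Δ ⊢ x ∈ᶠ t → Δ ⊢ y ∈ᶠ t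
  ∈-congL {x = x} {y} {t} e d = subst (λ w → _ ⊢ y ∈ᶠ w) (sub0-wk y t)
    (≐-subst (var here ∈ᶠ wkT t) (at-∈ _ _) e (subst (λ w → _ ⊢ x ∈ᶠ w) (sym (sub0-wk x t)) d))

  ∈-congR : ∀ {Γ} {Δ : List (Fm Γ)} {ρ} {x : Tm Γ ρ} {t t'} → Δ ⊢ t ≐ t' → Δ ⊢ x ∈ᶠ t → Δ ⊢ x ∈ᶠ t'
  ∈-congR {x = x} {t} {t'} e d = subst (λ w → _ ⊢ w ∈ᶠ t') (sub0-wk t' x)
    (≐-subst (wkT x ∈ᶠ var here) (at-∈ _ _) e (subst (λ w → _ ⊢ w ∈ᶠ t) (sym (sub0-wk t x)) d))

  s-mem : ∀ {Γ} {Δ : List (Fm Γ)} {ρ} (x : Tm Γ ρ) → Δ ⊢ x ∈ᶠ `s ρ · x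
  s-mem x = iff← (ilax (s-ax x x)) (≐refl x)

  ∪-memL : ∀ {Γ} {Δ : List (Fm Γ)} {ρ} {w : Tm Γ ρ} {x} y → Δ ⊢ w ∈ᶠ x → Δ ⊢ w ∈ᶠ `∪ ρ · x · y
  ∪-memL y d = iff← (ilax (∪-ax _ _ y)) (∨I₁ _ d)

  ∪-memR : ∀ {Γ} {Δ : List (Fm Γ)} {ρ} {w : Tm Γ ρ} x {y} → Δ ⊢ w ∈ᶠ y → Δ ⊢ w ∈ᶠ `∪ ρ · x · y
  ∪-memR x d = iff← (ilax (∪-ax _ x _)) (∨I₂ _ d)

  ⋃-mem : ∀ {Γ} {Δ : List (Fm Γ)} {σ τ} {z : Tm Γ σ} {x} {w : Tm Γ τ} {y} → Δ ⊢ z ∈ᶠ x → Δ ⊢ w ∈ᶠ y · z → Δ ⊢ w ∈ᶠ `⋃ σ τ · x · y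
  ⋃-mem d e = ⇒E (ilax (⋃-ax _ _ _ _)) (∧I d e)

  ∀unpack : ∀ {Γ} {Δ : List (Fm Γ)} {ρ} {A} → Δ ⊢ ∀ᶠ ρ A → map wkF Δ ⊢ A
  ∀unpack {A = A} d = cast⊢ (inst-var0 A) (∀E (wkH d) (var here))

  ∀∈E : ∀ {Γ} {Δ : List (Fm Γ)} {ρ} {t} {A : Fm (ρ ∷ Γ)} → Δ ⊢ ∀∈ ρ t A → (u : Tm Γ ρ) → Δ ⊢ u ∈ᶠ t → Δ ⊢ A [ u ]
  ∀∈E {t = t} {A} d u m = ⇒E (cast⊢ (cong (λ w → (u ∈ᶠ w) ⇒ᶠ A [ u ]) (sub0-wk u t)) (∀E (iff→ (ilax (ball t A)) d) u)) m

  ∀∈I : ∀ {Γ} {Δ : List (Fm Γ)} {ρ} {t} {A : Fm (ρ ∷ Γ)} → ((var here ∈ᶠ wkT t) ∷ map wkF Δ) ⊢ A → Δ ⊢ ∀∈ ρ t A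
  ∀∈I {t = t} {A} d = iff← (ilax (ball t A)) (∀I (⇒I d))

  ∃∈I : ∀ {Γ} {Δ : List (Fm Γ)} {ρ} {t} (A : Fm (ρ ∷ Γ)) (u : Tm Γ ρ) → Δ ⊢ u ∈ᶠ t → Δ ⊢ A [ u ] → Δ ⊢ ∃∈ ρ t A
  ∃∈I {t = t} A u m d = iff← (ilax (bex t A)) (∃I _ u (∧I (subst (λ w → _ ⊢ u ∈ᶠ w) (sym (sub0-wk u t)) m) d))

  ∃∈E : ∀ {Γ} {Δ : List (Fm Γ)} {ρ} {t} {A : Fm (ρ ∷ Γ)} {C} → Δ ⊢ ∃∈ ρ t A
      → ((var here ∈ᶠ wkT t) ∷ A ∷ map wkF Δ) ⊢ wkF C → Δ ⊢ C
  ∃∈E {t = t} {A} d e = ∃E (iff→ (ilax (bex t A)) d)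
    (⇒E (⇒E (wk1 (⇒I (⇒I e))) (∧E₂ (hyp (here refl)))) (∧E₁ (hyp (here refl))))

  ∀*E : ∀ {Γ Δ} {H : List (Fm Δ)} ws (σ : Sub Γ Δ) (φ : Fm (extCtx Γ ws)) → H ⊢ subF σ (∀* ws φ) → (xs : Tms Δ ws) → H ⊢ subF (appendS ws σ xs) φ
  ∀*E [] σ φ d []ₜ = d
  ∀*E (w ∷ ws) σ φ d (x ∷ₜ xs) =
    ∀*E ws (σ ,ˢ x) φ (cast⊢ (trans (subF-subF (extS σ) (sub0S x) _) (subF-cong (extS-sub0-,ˢ σ x) _)) (∀E d x)) xs

  ∀*E0 : ∀ {Γ} {H : List (Fm Γ)} ws (φ : Fm (extCtx Γ ws)) → H ⊢ ∀* ws φ → (xs : Tms Γ ws) → H ⊢ subF (appendS ws var xs) φ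
  ∀*E0 ws φ d xs = ∀*E ws var φ (cast⊢ (sym (subF-id _)) d) xs

  ∀*I : ∀ {Γ} {H : List (Fm Γ)} ws (φ : Fm (extCtx Γ ws)) → map (renF (wk* ws)) H ⊢ φ → H ⊢ ∀* ws φ
  ∀*I [] φ d = castH (map-renF-id _) d
  ∀*I {H = H} (w ∷ ws) φ d = ∀I (∀*I ws φ (castH (sym (map-renF-renF there (wk* ws) H)) d))


module Congruence (T : Fm [] → Set) where
  open Derivable T public

  EqS : ∀ {Γ Γ'} → List (Fm Γ') → Sub Γ Γ' → Sub Γ Γ' → Set
  EqS {Γ} H θ θ' = ∀ {τ} (v : Γ ∋ τ) → H ⊢ θ v ≐ θ' v

  EqS-refl : ∀ {Γ Γ'} {H : List (Fm Γ')} (θ : Sub Γ Γ') → EqS H θ θ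
  EqS-refl θ v = ≐refl (θ v)

  EqS-≡ : ∀ {Γ Γ'} {H : List (Fm Γ')} {θ θ' : Sub Γ Γ'} → θ ≗ˢ θ' → EqS H θ θ'
  EqS-≡ e v rewrite e v = ≐refl _

  EqS-sym : ∀ {Γ Γ'} {H : List (Fm Γ')} {θ θ' : Sub Γ Γ'} → EqS H θ θ' → EqS H θ' θ
  EqS-sym e v = ≐sym (e v)

  EqS-wk1 : ∀ {Γ Γ'} {H : List (Fm Γ')} {B} {θ θ' : Sub Γ Γ'} → EqS H θ θ' → EqS (B ∷ H) θ θ'
  EqS-wk1 e v = wk1 (e v)

  EqS-ext : ∀ {Γ Γ' ρ} {H : List (Fm Γ')} {θ θ' : Sub Γ Γ'} → EqS H θ θ' → EqS (map wkF H) (extS {σ = ρ} θ) (extS θ')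
  EqS-ext e here = ≐refl _
  EqS-ext e (there v) = wkH (e v)

  subT-cong-≐ : ∀ {Γ Γ'} {H : List (Fm Γ')} {θ θ' : Sub Γ Γ'} → EqS H θ θ' → ∀ {τ} (t : Tm Γ τ) → H ⊢ subT θ t ≐ subT θ' t
  subT-cong-≐ e (var v) = e v
  subT-cong-≐ e `0 = ≐refl _
  subT-cong-≐ e `S = ≐refl _
  subT-cong-≐ e (`R _) = ≐refl _
  subT-cong-≐ e (`Π _ _) = ≐refl _
  subT-cong-≐ e (`Σ _ _ _) = ≐refl _
  subT-cong-≐ e (`s _) = ≐refl _
  subT-cong-≐ e (`∪ _) = ≐refl _
  subT-cong-≐ e (`⋃ _ _) = ≐refl _
  subT-cong-≐ e (t · u) = ·-cong (subT-cong-≐ e t) (subT-cong-≐ e u)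

  subF-cong-⊢ : ∀ {Γ} (A : Fm Γ) {Γ'} {H : List (Fm Γ')} {θ θ' : Sub Γ Γ'} → EqS H θ θ' → H ⊢ subF θ A → H ⊢ subF θ' A
  subF-cong-⊢ ⊥ᶠ e d = d
  subF-cong-⊢ (t ≐ q) e d = ≐trans (≐sym (subT-cong-≐ e t)) (≐trans d (subT-cong-≐ e q))
  subF-cong-⊢ (t ∈ᶠ q) e d = ∈-congR (subT-cong-≐ e q) (∈-congL (subT-cong-≐ e t) d)
  subF-cong-⊢ (A ∨ᶠ B) e d = ∨E d (∨I₁ _ (subF-cong-⊢ A (EqS-wk1 e) (hyp (here refl)))) (∨I₂ _ (subF-cong-⊢ B (EqS-wk1 e) (hyp (here refl))))
  subF-cong-⊢ (A ∧ᶠ B) e d = ∧I (subF-cong-⊢ A e (∧E₁ d)) (subF-cong-⊢ B e (∧E₂ d))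
  subF-cong-⊢ (A ⇒ᶠ B) e d = ⇒I (subF-cong-⊢ B (EqS-wk1 e) (⇒E (wk1 d) (subF-cong-⊢ A (EqS-wk1 (EqS-sym e)) (hyp (here refl)))))
  subF-cong-⊢ (∀ᶠ ρ A) e d = ∀I (subF-cong-⊢ A (EqS-ext e) (∀unpack d))
  subF-cong-⊢ (∃ᶠ ρ A) e d = ∃E d (∃I _ (var here) (cast⊢ (sym (inst-var0 _)) (subF-cong-⊢ A (EqS-wk1 (EqS-ext e)) (hyp (here refl)))))
  subF-cong-⊢ (∀∈ ρ t A) e d = ∀∈I (subF-cong-⊢ A (EqS-wk1 (EqS-ext e))
    (cast⊢ (inst-var0 _) (∀∈E (wk1 (wkH d)) (var here) (∈-congR (wk1 (wkH (subT-cong-≐ (EqS-sym e) t))) (hyp (here refl))))))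
  subF-cong-⊢ (∃∈ ρ t A) e d = ∃∈E d (∃∈I _ (var here)
    (∈-congR (wk1 (wk1 (wkH (subT-cong-≐ e t)))) (hyp (here refl)))
    (cast⊢ (sym (inst-var0 _)) (subF-cong-⊢ A (EqS-wk1 (EqS-wk1 (EqS-ext e))) (hyp (there (here refl))))))

  EqT : ∀ {Δ ws} → List (Fm Δ) → Tms Δ ws → Tms Δ ws → Set
  EqT H []ₜ []ₜ = ⊤
  EqT H (x ∷ₜ xs) (y ∷ₜ ys) = (H ⊢ x ≐ y) × EqT H xs ys

  EqT-refl : ∀ {Δ ws} {H : List (Fm Δ)} (xs : Tms Δ ws) → EqT H xs xs
  EqT-refl []ₜ = tt
  EqT-refl (x ∷ₜ xs) = ≐refl x , EqT-refl xs

  EqT-sym : ∀ {Δ ws} {H : List (Fm Δ)} {xs ys : Tms Δ ws} → EqT H xs ys → EqT H ys xs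
  EqT-sym {xs = []ₜ} {[]ₜ} e = tt
  EqT-sym {xs = x ∷ₜ xs} {y ∷ₜ ys} (e , es) = ≐sym e , EqT-sym es

  EqT-trans : ∀ {Δ ws} {H : List (Fm Δ)} {xs ys zs : Tms Δ ws} → EqT H xs ys → EqT H ys zs → EqT H xs zs
  EqT-trans {xs = []ₜ} {[]ₜ} {[]ₜ} e f = tt
  EqT-trans {xs = x ∷ₜ xs} {y ∷ₜ ys} {z ∷ₜ zs} (e , es) (f , fs) = ≐trans e f , EqT-trans es fs

  EqT-≡ : ∀ {Δ ws} {H : List (Fm Δ)} {xs ys : Tms Δ ws} → xs ≡ ys → EqT H xs ys
  EqT-≡ {xs = xs} refl = EqT-refl xs

  EqT-wk : ∀ {Δ ρ ws} {H : List (Fm Δ)} {xs ys : Tms Δ ws} → EqT H xs ys → EqT (map (wkF {σ = ρ}) H) (renTms there xs) (renTms there ys)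
  EqT-wk {xs = []ₜ} {[]ₜ} e = tt
  EqT-wk {xs = x ∷ₜ xs} {y ∷ₜ ys} (e , es) = wkH e , EqT-wk es

  EqT-weak : ∀ {Δ ws} {H H' : List (Fm Δ)} → H ⊆ H' → {xs ys : Tms Δ ws} → EqT H xs ys → EqT H' xs ys
  EqT-weak s {[]ₜ} {[]ₜ} e = tt
  EqT-weak s {x ∷ₜ xs} {y ∷ₜ ys} (e , es) = weakD s e , EqT-weak s es

  EqS-appendS : ∀ {Γ Δ} {H : List (Fm Δ)} ws {σ σ' : Sub Γ Δ} {xs ys : Tms Δ ws} → EqS H σ σ' → EqT H xs ys
              → EqS H (appendS ws σ xs) (appendS ws σ' ys)
  EqS-appendS [] {xs = []ₜ} {[]ₜ} e f = e
  EqS-appendS (w ∷ ws) {xs = x ∷ₜ xs} {y ∷ₜ ys} e (f , fs) = EqS-appendS ws e' fs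
    where
    e' : EqS _ (_ ,ˢ x) (_ ,ˢ y)
    e' here = f
    e' (there v) = e v

  HRs-as-sub : ∀ {Γ Δ} (A : Fm Γ) (σ : Sub Γ Δ) (xs : Tms Δ (W A))
             → HRs A σ xs ≡ subF (appendS (W A) σ xs) (HRs A (λ v → var (wk* (W A) v)) (vars* (W A)))
  HRs-as-sub A σ xs = sym (trans (subF-HRs A _ (appendS (W A) σ xs) (vars* (W A)))
    (trans (cong (HRs A _) (appendS-vars* (W A) σ xs)) (HRs-cong A (appendS-wk* (W A) σ xs) xs)))

  HRs-eq : ∀ {Γ Δ} {H : List (Fm Δ)} (A : Fm Γ) {σ σ' : Sub Γ Δ} {xs ys : Tms Δ (W A)} → EqS H σ σ' → EqT H xs ys
         → H ⊢ HRs A σ xs → H ⊢ HRs A σ' ys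
  HRs-eq A {σ} {σ'} {xs} {ys} e f d =
    cast⊢ (sym (HRs-as-sub A σ' ys)) (subF-cong-⊢ _ (EqS-appendS (W A) e f) (cast⊢ (HRs-as-sub A σ xs) d))

  HRs-eqT : ∀ {Γ Δ} {H : List (Fm Δ)} (A : Fm Γ) {σ : Sub Γ Δ} {xs ys : Tms Δ (W A)} → EqT H xs ys
          → H ⊢ HRs A σ xs → H ⊢ HRs A σ ys
  HRs-eqT A {σ} f d = HRs-eq A (EqS-refl σ) f d


-- Bracket abstraction with the combinators Σ (= S) and Π (= K).
I-comb : ∀ {Γ} ρ → Tm Γ (ρ ⇒ ρ)
I-comb ρ = `Σ ρ (ρ ⇒ ρ) ρ · `Π ρ (ρ ⇒ ρ) · `Π ρ ρ

lam : ∀ {Γ ρ τ} → Tm (ρ ∷ Γ) τ → Tm Γ (ρ ⇒ τ)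
lam {ρ = ρ} (var here) = I-comb ρ
lam {ρ = ρ} {τ} (var (there v)) = `Π τ ρ · var v
lam {ρ = ρ} {τ} `0 = `Π τ ρ · `0
lam {ρ = ρ} {τ} `S = `Π τ ρ · `S
lam {ρ = ρ} {τ} (`R σ) = `Π τ ρ · `R σ
lam {ρ = ρ} {τ} (`Π σ τ₁) = `Π τ ρ · `Π σ τ₁
lam {ρ = ρ} {τ} (`Σ ρ₁ σ τ₁) = `Π τ ρ · `Σ ρ₁ σ τ₁
lam {ρ = ρ} {τ} (`s σ) = `Π τ ρ · `s σ
lam {ρ = ρ} {τ} (`∪ σ) = `Π τ ρ · `∪ σ
lam {ρ = ρ} {τ} (`⋃ σ τ₁) = `Π τ ρ · `⋃ σ τ₁
lam {ρ = ρ} {τ} (_·_ {σ} t u) = `Σ ρ σ τ · lam t · lam u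

wk-var0 : ∀ {Γ ρ} → ((λ {τ} (v : Γ ∋ τ) → var (there {σ = ρ} v)) ,ˢ var here) ≗ˢ var
wk-var0 here = refl
wk-var0 (there v) = refl

lams : ∀ {Γ ρ} us → Tms (ρ ∷ Γ) us → Tms Γ (map (ρ ⇒_) us)
lams [] []ₜ = []ₜ
lams (u ∷ us) (x ∷ₜ xs) = lam x ∷ₜ lams us xs

lam* : ∀ {Γ u} ws → Tm (extCtx Γ ws) u → Tm Γ (ws ⇛ u)
lam* [] t = t
lam* (w ∷ ws) t = lam (lam* ws t)

lams* : ∀ {Γ} ws us → Tms (extCtx Γ ws) us → Tms Γ (map (ws ⇛_) us)
lams* ws [] []ₜ = []ₜ
lams* ws (u ∷ us) (y ∷ₜ ys) = lam* ws y ∷ₜ lams* ws us ys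

lamC : ∀ Γ {τ} → Tm Γ τ → Tm [] (Γ ⇛ᶜ τ)
lamC [] t = t
lamC (σ ∷ Γ) t = lamC Γ (lam t)

lamCs : ∀ Γ ws → Tms Γ ws → Tms [] (map (Γ ⇛ᶜ_) ws)
lamCs Γ [] []ₜ = []ₜ
lamCs Γ (w ∷ ws) (x ∷ₜ xs) = lamC Γ x ∷ₜ lamCs Γ ws xs

defaultTm : ∀ {Γ} τ → Tm Γ τ
defaultTm N = `0
defaultTm (σ ⇒ τ) = `Π τ σ · defaultTm τ
defaultTm (σ *) = `s σ · defaultTm σ

defaultTms : ∀ {Γ} ws → Tms Γ ws
defaultTms [] = []ₜ
defaultTms (w ∷ ws) = defaultTm w ∷ₜ defaultTms ws


module Combinators (T : Fm [] → Set) where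
  open Congruence T public

  lam-β : ∀ {Γ Δ ρ τ} {H : List (Fm Δ)} (σ : Sub Γ Δ) (u : Tm Δ ρ) (t : Tm (ρ ∷ Γ) τ) → H ⊢ subT σ (lam t) · u ≐ subT (σ ,ˢ u) t
  lam-β σ u (var here) = ≐trans (ilax (Σ-ax _ _ u)) (ilax (Π-ax u _))
  lam-β σ u (var (there v)) = ilax (Π-ax _ u)
  lam-β σ u `0 = ilax (Π-ax _ u)
  lam-β σ u `S = ilax (Π-ax _ u)
  lam-β σ u (`R _) = ilax (Π-ax _ u)
  lam-β σ u (`Π _ _) = ilax (Π-ax _ u)
  lam-β σ u (`Σ _ _ _) = ilax (Π-ax _ u)
  lam-β σ u (`s _) = ilax (Π-ax _ u)
  lam-β σ u (`∪ _) = ilax (Π-ax _ u)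
  lam-β σ u (`⋃ _ _) = ilax (Π-ax _ u)
  lam-β σ u (t · t₁) = ≐trans (ilax (Σ-ax _ _ u)) (·-cong (lam-β σ u t) (lam-β σ u t₁))

  lam-β-var0 : ∀ {Γ ρ τ} {H : List (Fm (ρ ∷ Γ))} (t : Tm (ρ ∷ Γ) τ) → H ⊢ wkT (lam t) · var here ≐ t
  lam-β-var0 t = cast⊢ (cong₂ (λ a b → a · var here ≐ b) (sym (renT-sub there (lam t))) (trans (subT-cong wk-var0 t) (subT-id t)))
    (lam-β (λ v → var (there v)) (var here) t)

  appVar0-lams : ∀ {Γ ρ} {H : List (Fm (ρ ∷ Γ))} us (xs : Tms (ρ ∷ Γ) us) → EqT H (appVar0 us (lams us xs)) xs
  appVar0-lams [] []ₜ = tt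
  appVar0-lams (u ∷ us) (x ∷ₜ xs) = lam-β-var0 x , appVar0-lams us xs

  appTms-congˡ : ∀ {Γ ws u} {H : List (Fm Γ)} {f g : Tm Γ (ws ⇛ u)} (xs : Tms Γ ws) → H ⊢ f ≐ g → H ⊢ appTms f xs ≐ appTms g xs
  appTms-congˡ []ₜ e = e
  appTms-congˡ (x ∷ₜ xs) e = appTms-congˡ xs (·-cong e (≐refl x))

  lam*-β : ∀ {Γ Δ u} {H : List (Fm Δ)} ws (σ : Sub Γ Δ) (t : Tm (extCtx Γ ws) u) (xs : Tms Δ ws)
         → H ⊢ appTms (subT σ (lam* ws t)) xs ≐ subT (appendS ws σ xs) t
  lam*-β [] σ t []ₜ = ≐refl _
  lam*-β (w ∷ ws) σ t (x ∷ₜ xs) = ≐trans (appTms-congˡ xs (lam-β σ x (lam* ws t))) (lam*-β ws (σ ,ˢ x) t xs)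

  lam*-β-vars* : ∀ {Γ u} ws {H : List (Fm (extCtx Γ ws))} (t : Tm (extCtx Γ ws) u) → H ⊢ appTms (renT (wk* ws) (lam* ws t)) (vars* ws) ≐ t
  lam*-β-vars* ws t = cast⊢ (cong₂ (λ a b → appTms a (vars* ws) ≐ b) (sym (renT-sub (wk* ws) (lam* ws t))) (trans (subT-cong (appendS-id ws) t) (subT-id t)))
    (lam*-β ws (λ v → var (wk* ws v)) t (vars* ws))

  appAll-lams* : ∀ {Γ} ws us {H : List (Fm (extCtx Γ ws))} (ys : Tms (extCtx Γ ws) us)
               → EqT H (appAll ws us (renTms (wk* ws) (lams* ws us ys)) (vars* ws)) ys
  appAll-lams* ws [] []ₜ = tt
  appAll-lams* ws (u ∷ us) (y ∷ₜ ys) = lam*-β-vars* ws y , appAll-lams* ws us ys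

  appCtx-lamC : ∀ Γ {τ} (t : Tm Γ τ) → [] ⊢ appCtx Γ (lamC Γ t) ≐ t
  appCtx-lamC [] t = ≐refl t
  appCtx-lamC (σ ∷ Γ) t = ≐trans (·-cong (wkH (appCtx-lamC Γ (lam t))) (≐refl (var here))) (lam-β-var0 t)

  appCtxs-lamCs : ∀ Γ ws (xs : Tms Γ ws) → EqT [] (appCtxs Γ ws (lamCs Γ ws xs)) xs
  appCtxs-lamCs Γ [] []ₜ = tt
  appCtxs-lamCs Γ (w ∷ ws) (x ∷ₜ xs) = appCtx-lamC Γ x , appCtxs-lamCs Γ ws xs

  appTms-congʳ : ∀ {Δ ws u} {H : List (Fm Δ)} (f : Tm Δ (ws ⇛ u)) {xs ys : Tms Δ ws} → EqT H xs ys → H ⊢ appTms f xs ≐ appTms f ys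
  appTms-congʳ f {[]ₜ} {[]ₜ} e = ≐refl f
  appTms-congʳ f {x ∷ₜ xs} {y ∷ₜ ys} (e , es) = ≐trans (appTms-congˡ xs (·-cong (≐refl f) e)) (appTms-congʳ (f · y) es)

  lams*-β : ∀ {Θ Δ} ws us {H : List (Fm Δ)} (σ : Sub Θ Δ) (ys : Tms (extCtx Θ ws) us) (xs : Tms Δ ws)
          → EqT H (appAll ws us (subTms σ (lams* ws us ys)) xs) (subTms (appendS ws σ xs) ys)
  lams*-β ws [] σ []ₜ xs = tt
  lams*-β ws (u ∷ us) σ (y ∷ₜ ys) xs = lam*-β ws σ y xs , lams*-β ws us σ ys xs


-- Hereditary inclusion of candidate sets; on N it is trivially true, encoded as 0 = 0.
⊑F : ∀ {Γ} τ → Tm Γ τ → Tm Γ τ → Fm Γ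
⊑F N x y = `0 ≐ `0
⊑F (σ ⇒ τ) x y = ∀ᶠ σ (⊑F τ (wkT x · var here) (wkT y · var here))
⊑F (σ *) x y = ∀∈ σ x (var here ∈ᶠ wkT y)

⊑-sub : ∀ {Γ Δ} τ (θ : Sub Γ Δ) (x y : Tm Γ τ) → subF θ (⊑F τ x y) ≡ ⊑F τ (subT θ x) (subT θ y)
⊑-sub N θ x y = refl
⊑-sub (σ ⇒ τ) θ x y = cong (∀ᶠ σ) (trans (⊑-sub τ (extS θ) _ _)
  (cong₂ (λ a b → ⊑F τ (a · var here) (b · var here)) (subT-wkT θ x) (subT-wkT θ y)))
⊑-sub (σ *) θ x y = cong (∀∈ σ (subT θ x)) (cong (var here ∈ᶠ_) (subT-wkT θ y))

⊑-ren : ∀ {Γ Δ} τ (r : Ren Γ Δ) (x y : Tm Γ τ) → renF r (⊑F τ x y) ≡ ⊑F τ (renT r x) (renT r y)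
⊑-ren τ r x y = trans (renF-sub r _) (trans (⊑-sub τ _ x y) (sym (cong₂ (⊑F τ) (renT-sub r x) (renT-sub r y))))


module Majorization (T : Fm [] → Set) where
  open Combinators T public

  ⊑-wk : ∀ {Γ ρ τ} {H : List (Fm Γ)} {x y : Tm Γ τ} → H ⊢ ⊑F τ x y → map wkF H ⊢ ⊑F τ (wkT {σ = ρ} x) (wkT y)
  ⊑-wk {τ = τ} d = cast⊢ (⊑-ren τ there _ _) (wkH d)

  ⊑-eq : ∀ {Γ} τ {H : List (Fm Γ)} {x x' y y' : Tm Γ τ} → H ⊢ x ≐ x' → H ⊢ y ≐ y' → H ⊢ ⊑F τ x y → H ⊢ ⊑F τ x' y'
  ⊑-eq {Γ} τ {H} {x} {x'} {y} {y'} e f d =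
    cast⊢ (⊑-sub τ θ' _ _) (subF-cong-⊢ (⊑F τ (var (there here)) (var here)) eqs (cast⊢ (sym (⊑-sub τ θ _ _)) d))
    where
    θ θ' : Sub (τ ∷ τ ∷ Γ) Γ
    θ = (var ,ˢ x) ,ˢ y
    θ' = (var ,ˢ x') ,ˢ y'
    eqs : EqS H θ θ'
    eqs here = f
    eqs (there here) = e
    eqs (there (there v)) = ≐refl _

  ⊑-app* : ∀ {Γ u} ws {H : List (Fm Γ)} {U U' : Tm Γ (ws ⇛ u)} → H ⊢ ⊑F (ws ⇛ u) U U' → (xs : Tms Γ ws)
         → H ⊢ ⊑F u (appTms U xs) (appTms U' xs)
  ⊑-app* [] d []ₜ = d
  ⊑-app* {u = u} (w ∷ ws) {U = U} {U'} d (x ∷ₜ xs) =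
    ⊑-app* ws (cast⊢ (trans (⊑-sub (ws ⇛ u) (sub0S x) _ _) (cong₂ (λ a b → ⊑F (ws ⇛ u) (a · x) (b · x)) (sub0-wk x U) (sub0-wk x U'))) (∀E d x)) xs

  ⊑Tms : ∀ {Δ ws} → List (Fm Δ) → Tms Δ ws → Tms Δ ws → Set
  ⊑Tms H []ₜ []ₜ = ⊤
  ⊑Tms H (_∷ₜ_ {τ} x xs) (y ∷ₜ ys) = (H ⊢ ⊑F τ x y) × ⊑Tms H xs ys

  ⊑Tms-wk1 : ∀ {Δ ws} {H : List (Fm Δ)} {B} {xs ys : Tms Δ ws} → ⊑Tms H xs ys → ⊑Tms (B ∷ H) xs ys
  ⊑Tms-wk1 {xs = []ₜ} {[]ₜ} l = tt
  ⊑Tms-wk1 {xs = x ∷ₜ xs} {y ∷ₜ ys} (d , l) = wk1 d , ⊑Tms-wk1 l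

  ⊑Tms-wk : ∀ {Δ ρ ws} {H : List (Fm Δ)} {xs ys : Tms Δ ws} → ⊑Tms H xs ys → ⊑Tms (map wkF H) (renTms (there {σ = ρ}) xs) (renTms there ys)
  ⊑Tms-wk {xs = []ₜ} {[]ₜ} l = tt
  ⊑Tms-wk {xs = x ∷ₜ xs} {y ∷ₜ ys} (d , l) = ⊑-wk d , ⊑Tms-wk l

  ⊑Tms-ren : ∀ {Δ Θ ws} {H : List (Fm Δ)} (r : Ren Δ Θ) {xs ys : Tms Δ ws} → ⊑Tms H xs ys → ⊑Tms (map (renF r) H) (renTms r xs) (renTms r ys)
  ⊑Tms-ren r {[]ₜ} {[]ₜ} l = tt
  ⊑Tms-ren r {_∷ₜ_ {τ} x xs} {y ∷ₜ ys} (d , l) = cast⊢ (⊑-ren τ r x y) (renH r d) , ⊑Tms-ren r l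

  ⊑Tms-split : ∀ {Δ} {H : List (Fm Δ)} as bs {xs ys : Tms Δ (as ++ bs)} → ⊑Tms H xs ys
             → ⊑Tms H (proj₁ (splitTms as bs xs)) (proj₁ (splitTms as bs ys)) × ⊑Tms H (proj₂ (splitTms as bs xs)) (proj₂ (splitTms as bs ys))
  ⊑Tms-split [] bs l = tt , l
  ⊑Tms-split (a ∷ as) bs {x ∷ₜ xs} {y ∷ₜ ys} (d , l) with ⊑Tms-split as bs l
  ... | l1 , l2 = (d , l1) , l2

  ⊑Tms-appVar0 : ∀ {Δ ρ} ws {H : List (Fm Δ)} {Xs Ys : Tms Δ (map (ρ ⇒_) ws)} → ⊑Tms H Xs Ys
               → ⊑Tms (map wkF H) (appVar0 ws Xs) (appVar0 ws Ys)
  ⊑Tms-appVar0 [] {Xs = []ₜ} {[]ₜ} l = tt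
  ⊑Tms-appVar0 (w ∷ ws) {Xs = X ∷ₜ Xs} {Y ∷ₜ Ys} (d , l) = ∀unpack d , ⊑Tms-appVar0 ws l

  ⊑Tms-appAll : ∀ {Δ} ws us {H : List (Fm Δ)} {Us Us' : Tms Δ (map (ws ⇛_) us)} → ⊑Tms H Us Us' → (xs : Tms Δ ws)
              → ⊑Tms H (appAll ws us Us xs) (appAll ws us Us' xs)
  ⊑Tms-appAll ws [] {Us = []ₜ} {[]ₜ} l xs = tt
  ⊑Tms-appAll ws (u ∷ us) {Us = U ∷ₜ Us} {U' ∷ₜ Us'} (d , l) xs = ⊑-app* ws d xs , ⊑Tms-appAll ws us l xs

  ∀*unpack : ∀ {Γ} {H : List (Fm Γ)} ws (φ : Fm (extCtx Γ ws)) → H ⊢ ∀* ws φ → map (renF (wk* ws)) H ⊢ φ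
  ∀*unpack ws φ d = cast⊢ (trans (subF-cong (appendS-id ws) φ) (subF-id φ))
    (∀*E ws (λ v → var (wk* ws v)) φ (cast⊢ (renF-sub (wk* ws) _) (renH (wk* ws) d)) (vars* ws))

  HRs-mono : ∀ {Γ Δ} (A : Fm Γ) (σ : Sub Γ Δ) {H : List (Fm Δ)} {xs ys : Tms Δ (W A)} → ⊑Tms H xs ys → H ⊢ HRs A σ xs → H ⊢ HRs A σ ys
  HRs-mono ⊥ᶠ σ l d = d
  HRs-mono (t ≐ q) σ l d = d
  HRs-mono (t ∈ᶠ q) σ l d = d
  HRs-mono (A ∨ᶠ B) σ l d with ⊑Tms-split (W A) (W B) l
  ... | l1 , l2 = ∨E d (∨I₁ _ (HRs-mono A σ (⊑Tms-wk1 l1) (hyp (here refl)))) (∨I₂ _ (HRs-mono B σ (⊑Tms-wk1 l2) (hyp (here refl))))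
  HRs-mono (A ∧ᶠ B) σ l d with ⊑Tms-split (W A) (W B) l
  ... | l1 , l2 = ∧I (HRs-mono A σ l1 (∧E₁ d)) (HRs-mono B σ l2 (∧E₂ d))
  HRs-mono (A ⇒ᶠ B) σ {xs = Us} {Us'} l d =
    ∀*I (W A) _ (⇒I (HRs-mono B _ (⊑Tms-wk1 (⊑Tms-appAll (W A) (W B) (⊑Tms-ren (wk* (W A)) l) (vars* (W A))))
      (⇒E (wk1 (∀*unpack (W A) _ d)) (hyp (here refl)))))
  HRs-mono (∀ᶠ ρ A) σ l d = ∀I (HRs-mono A (extS σ) (⊑Tms-appVar0 (W A) l) (∀unpack d))
  HRs-mono (∃ᶠ ρ A) σ {xs = Z ∷ₜ xs} {Z' ∷ₜ ys} (dZ , l) d = ∃∈E d (∃∈I _ (var here)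
    (cast⊢ (inst-var0 _) (∀∈E (wk1 (wk1 (wkH dZ))) (var here) (hyp (here refl))))
    (cast⊢ (sym (inst-var0 _)) (HRs-mono A (extS σ) (⊑Tms-wk1 (⊑Tms-wk1 (⊑Tms-wk l))) (hyp (there (here refl))))))
  HRs-mono (∀∈ ρ t A) σ l d = ∀∈I (HRs-mono A (extS σ) (⊑Tms-wk1 (⊑Tms-wk l))
    (cast⊢ (inst-var0 _) (∀∈E (wk1 (wkH d)) (var here) (hyp (here refl)))))
  HRs-mono (∃∈ ρ t A) σ l d = ∃∈E d (∃∈I _ (var here) (hyp (here refl))
    (cast⊢ (sym (inst-var0 _)) (HRs-mono A (extS σ) (⊑Tms-wk1 (⊑Tms-wk1 (⊑Tms-wk l))) (hyp (there (here refl))))))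


-- On N any choice does, as ⊑ is trivial there.
∪̂ : ∀ {Γ} τ → Tm Γ τ → Tm Γ τ → Tm Γ τ
∪̂ N x y = x
∪̂ (σ ⇒ τ) x y = lam (∪̂ τ (wkT x · var here) (wkT y · var here))
∪̂ (σ *) x y = `∪ σ · x · y

∪̂s : ∀ {Γ} ws → Tms Γ ws → Tms Γ ws → Tms Γ ws
∪̂s [] []ₜ []ₜ = []ₜ
∪̂s (w ∷ ws) (x ∷ₜ xs) (y ∷ₜ ys) = ∪̂ w x y ∷ₜ ∪̂s ws xs ys

closeT : ∀ {Γ τ} → Tm [] τ → Tm Γ τ
closeT = renT (λ ())

closeT-sub : ∀ {Γ Δ τ} (θ : Sub Γ Δ) (t : Tm [] τ) → subT θ (closeT t) ≡ closeT t
closeT-sub θ t = trans (subT-renT _ θ t) (trans (subT-cong (λ ()) t) (sym (renT-sub _ t)))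

closeT-ren : ∀ {Γ Δ τ} (r : Ren Γ Δ) (t : Tm [] τ) → renT r (closeT t) ≡ closeT t
closeT-ren r t = trans (renT-sub r (closeT t)) (closeT-sub _ t)

-- A closed term, defined by recursion on the type, so that substitutions pass through ⋃̂ unchanged.
bigUnion : ∀ ρ τ → Tm [] (ρ * ⇒ (ρ ⇒ τ) ⇒ τ)

bigUnion-body : ∀ ρ τ → Tm ((ρ ⇒ τ) ∷ ρ * ∷ []) τ
bigUnion ρ τ = lam (lam (bigUnion-body ρ τ))
bigUnion-body ρ N = `0
bigUnion-body ρ (σ ⇒ τ) = lam (closeT (bigUnion ρ τ) · var (there (there here)) · lam (var (there (there here)) · var here · var (there here)))
bigUnion-body ρ (σ *) = `⋃ ρ σ · var (there here) · var here

⋃̂ : ∀ {Γ ρ} τ → Tm Γ (ρ *) → Tm Γ (ρ ⇒ τ) → Tm Γ τ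
⋃̂ {ρ = ρ} τ t X = closeT (bigUnion ρ τ) · t · X

emptyS : ∀ {Γ} → Sub [] Γ
emptyS ()

⋃̂s : ∀ {Γ ρ} ws → Tm Γ (ρ *) → Tms Γ (map (ρ ⇒_) ws) → Tms Γ ws
⋃̂s [] t []ₜ = []ₜ
⋃̂s (w ∷ ws) t (X ∷ₜ Xs) = ⋃̂ w t X ∷ₜ ⋃̂s ws t Xs

⋃̂s-ren : ∀ {Γ Δ ρ} ws (r : Ren Γ Δ) (t : Tm Γ (ρ *)) (Xs : Tms Γ (map (ρ ⇒_) ws)) → renTms r (⋃̂s ws t Xs) ≡ ⋃̂s ws (renT r t) (renTms r Xs)
⋃̂s-ren [] r t []ₜ = refl
⋃̂s-ren (w ∷ ws) r t (X ∷ₜ Xs) = cong₂ _∷ₜ_ (cong (λ a → a · renT r t · renT r X) (closeT-ren r _)) (⋃̂s-ren ws r t Xs)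


module Unions (T : Fm [] → Set) where
  open Majorization T public

  ⊑-∪L : ∀ {Γ} τ {H : List (Fm Γ)} (x y : Tm Γ τ) → H ⊢ ⊑F τ x (∪̂ τ x y)
  ⊑-∪L N x y = ≐refl `0
  ⊑-∪L (σ ⇒ τ) x y = ∀I (⊑-eq τ (≐refl _) (≐sym (lam-β-var0 _)) (⊑-∪L τ _ _))
  ⊑-∪L (σ *) x y = ∀∈I (∪-memL _ (hyp (here refl)))

  ⊑-∪R : ∀ {Γ} τ {H : List (Fm Γ)} (x y : Tm Γ τ) → H ⊢ ⊑F τ y (∪̂ τ x y)
  ⊑-∪R N x y = ≐refl `0
  ⊑-∪R (σ ⇒ τ) x y = ∀I (⊑-eq τ (≐refl _) (≐sym (lam-β-var0 _)) (⊑-∪R τ _ _))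
  ⊑-∪R (σ *) x y = ∀∈I (∪-memR _ (hyp (here refl)))

  ⊑Tms-∪L : ∀ {Γ} ws {H : List (Fm Γ)} (xs ys : Tms Γ ws) → ⊑Tms H xs (∪̂s ws xs ys)
  ⊑Tms-∪L [] []ₜ []ₜ = tt
  ⊑Tms-∪L (w ∷ ws) (x ∷ₜ xs) (y ∷ₜ ys) = ⊑-∪L w x y , ⊑Tms-∪L ws xs ys

  ⊑Tms-∪R : ∀ {Γ} ws {H : List (Fm Γ)} (xs ys : Tms Γ ws) → ⊑Tms H ys (∪̂s ws xs ys)
  ⊑Tms-∪R [] []ₜ []ₜ = tt
  ⊑Tms-∪R (w ∷ ws) (x ∷ₜ xs) (y ∷ₜ ys) = ⊑-∪R w x y , ⊑Tms-∪R ws xs ys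

  bigUnion-unfold : ∀ {Γ ρ} τ {H : List (Fm Γ)} (t : Tm Γ (ρ *)) (X : Tm Γ (ρ ⇒ τ)) → H ⊢ ⋃̂ τ t X ≐ subT ((emptyS ,ˢ t) ,ˢ X) (bigUnion-body ρ τ)
  bigUnion-unfold {ρ = ρ} τ t X = ≐trans (·-cong (cast⊢ (cong (λ a → a · t ≐ subT (emptyS ,ˢ t) (lam (bigUnion-body ρ τ))) (sym e1)) (lam-β emptyS t (lam (bigUnion-body ρ τ)))) (≐refl X))
    (lam-β (emptyS ,ˢ t) X (bigUnion-body ρ τ))
    where
    e1 : closeT (bigUnion ρ τ) ≡ subT emptyS (bigUnion ρ τ)
    e1 = trans (renT-sub _ (bigUnion ρ τ)) (subT-cong (λ ()) (bigUnion ρ τ))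

  ⊑-⋃ : ∀ {Γ ρ} τ {H : List (Fm Γ)} {u : Tm Γ ρ} (t : Tm Γ (ρ *)) (X : Tm Γ (ρ ⇒ τ)) → H ⊢ u ∈ᶠ t → H ⊢ ⊑F τ (X · u) (⋃̂ τ t X)
  ⊑-⋃ N t X m = ≐refl `0
  ⊑-⋃ (σ *) t X m = ⊑-eq (σ *) (≐refl _) (≐sym (bigUnion-unfold (σ *) t X)) (∀∈I (⋃-mem (wk1 (wkH m)) (hyp (here refl))))
  ⊑-⋃ {Γ} {ρ} (σ ⇒ τ) {H} {u} t X m = ⊑-eq (σ ⇒ τ) (≐refl _) (≐sym (bigUnion-unfold (σ ⇒ τ) t X)) (∀I step)
    where
    θ : Sub ((ρ ⇒ σ ⇒ τ) ∷ ρ * ∷ []) Γ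
    θ = (emptyS ,ˢ t) ,ˢ X
    σ' : Sub ((ρ ⇒ σ ⇒ τ) ∷ ρ * ∷ []) (σ ∷ Γ)
    σ' v = wkT (θ v)
    Fb : Tm (ρ ∷ σ ∷ (ρ ⇒ σ ⇒ τ) ∷ ρ * ∷ []) τ
    Fb = var (there (there here)) · var here · var (there here)
    F' : Tm (σ ∷ Γ) (ρ ⇒ τ)
    F' = subT (σ' ,ˢ var here) (lam Fb)
    R : Tm Γ (σ ⇒ τ)
    R = subT θ (bigUnion-body ρ (σ ⇒ τ))
    B2 : Tm (σ ∷ (ρ ⇒ σ ⇒ τ) ∷ ρ * ∷ []) τ
    B2 = closeT (bigUnion ρ τ) · var (there (there here)) · lam Fb
    eR : map wkF H ⊢ wkT R · var here ≐ ⋃̂ τ (wkT t) F'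
    eR = cast⊢ (cong₂ (λ a b → a · var here ≐ b · wkT t · F') (sym (renT-subT θ there (lam B2))) (closeT-sub (σ' ,ˢ var here) (bigUnion ρ τ)))
           (lam-β σ' (var here) B2)
    step : map wkF H ⊢ ⊑F τ (wkT (X · u) · var here) (wkT R · var here)
    step = ⊑-eq τ (lam-β (σ' ,ˢ var here) (wkT u) Fb) (≐sym eR) (⊑-⋃ τ (wkT t) F' (wkH m))

  ⊑Tms-⋃-var0 : ∀ {Γ ρ} ws {H : List (Fm (ρ ∷ Γ))} (t : Tm Γ (ρ *)) (Xs : Tms Γ (map (ρ ⇒_) ws)) → H ⊢ var here ∈ᶠ wkT t
              → ⊑Tms H (appVar0 ws Xs) (renTms there (⋃̂s ws t Xs))
  ⊑Tms-⋃-var0 {Γ} {ρ} ws {H} t Xs m = subst (⊑Tms H (appVar0 ws Xs)) (sym (⋃̂s-ren ws there t Xs)) (go ws Xs)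
    where
    go : ∀ ws (Xs : Tms Γ (map (ρ ⇒_) ws)) → ⊑Tms H (appVar0 ws Xs) (⋃̂s ws (wkT t) (renTms there Xs))
    go [] []ₜ = tt
    go (w ∷ ws) (X ∷ₜ Xs) = ⊑-⋃ w (wkT t) (wkT X) m , go ws Xs


wkS* : ∀ {Γ Γ'} ws → Sub Γ Γ' → Sub Γ (extCtx Γ' ws)
wkS* ws σ v = renT (wk* ws) (σ v)

wkS*-appendS : ∀ {Γ Γ'} ws (σ : Sub Γ Γ') (a : Tms Γ' ws) → (wkS* ws σ ⨾ appendS ws var a) ≗ˢ σ
wkS*-appendS ws σ a v = trans (subT-renT (wk* ws) _ (σ v)) (trans (subT-cong (appendS-wk* ws var a) (σ v)) (subT-id (σ v)))

appendS-wkTms : ∀ {Γ'} ws {us} (a : Tms Γ' ws) (U : Tms Γ' us) → subTms (appendS ws var a) (renTms (wk* ws) U) ≡ U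
appendS-wkTms ws a U = trans (subTms-renTms (wk* ws) _ U) (trans (subTms-cong (appendS-wk* ws var a) U) (subTms-id U))

ExFree-W : ∀ {Γ} {A : Fm Γ} → ExFree A → W A ≡ []
ExFree-W ef-⊥ = refl
ExFree-W (ef-≐ t q) = refl
ExFree-W (ef-∈ t q) = refl
ExFree-W (ef-∨ a b) = cong₂ _++_ (ExFree-W a) (ExFree-W b)
ExFree-W (ef-∧ a b) = cong₂ _++_ (ExFree-W a) (ExFree-W b)
ExFree-W {A = A ⇒ᶠ B} (ef-⇒ a b) = cong (map (W A ⇛_)) (ExFree-W b)
ExFree-W {A = ∀ᶠ ρ A} (ef-∀ a) = cong (map (ρ ⇒_)) (ExFree-W a)
ExFree-W (ef-∀∈ a) = ExFree-W a
ExFree-W (ef-∃∈ a) = ExFree-W a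

ExFree-HRs : ∀ {Γ Δ} {A : Fm Γ} → ExFree A → (σ : Sub Γ Δ) (xs : Tms Δ (W A)) → HRs A σ xs ≡ subF σ A
ExFree-HRs ef-⊥ σ xs = refl
ExFree-HRs (ef-≐ t q) σ xs = refl
ExFree-HRs (ef-∈ t q) σ xs = refl
ExFree-HRs (ef-∨ a b) σ xs = cong₂ _∨ᶠ_ (ExFree-HRs a σ _) (ExFree-HRs b σ _)
ExFree-HRs (ef-∧ a b) σ xs = cong₂ _∧ᶠ_ (ExFree-HRs a σ _) (ExFree-HRs b σ _)
ExFree-HRs {A = A ⇒ᶠ B} (ef-⇒ a b) σ xs =
  trans (∀*-castCtx p _) (cong₂ _⇒ᶠ_
    (trans (cong (renF (castCtx p)) (ExFree-HRs a _ _)) (trans (renF-subF _ (castCtx p) A) (subF-cong e A)))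
    (trans (cong (renF (castCtx p)) (ExFree-HRs b _ _)) (trans (renF-subF _ (castCtx p) B) (subF-cong e B))))
  where
  p = ExFree-W a
  e : ∀ {τ} (v : _ ∋ τ) → renT (castCtx p) (renT (wk* (W A)) (σ v)) ≡ σ v
  e v = trans (renT-renT _ _ (σ v)) (trans (renT-cong (castCtx-wk* p) (σ v)) (renT-id (σ v)))
ExFree-HRs (ef-∀ a) σ xs = cong (∀ᶠ _) (ExFree-HRs a (extS σ) _)
ExFree-HRs (ef-∀∈ a) σ xs = cong (∀∈ _ _) (ExFree-HRs a (extS σ) _)
ExFree-HRs (ef-∃∈ a) σ xs = cong (∃∈ _ _) (ExFree-HRs a (extS σ) _)

ExFree-sub : ∀ {Γ Δ} (s : Sub Γ Δ) {A : Fm Γ} → ExFree A → ExFree (subF s A)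
ExFree-sub s ef-⊥ = ef-⊥
ExFree-sub s (ef-≐ t q) = ef-≐ _ _
ExFree-sub s (ef-∈ t q) = ef-∈ _ _
ExFree-sub s (ef-∨ a b) = ef-∨ (ExFree-sub s a) (ExFree-sub s b)
ExFree-sub s (ef-∧ a b) = ef-∧ (ExFree-sub s a) (ExFree-sub s b)
ExFree-sub s (ef-⇒ a b) = ef-⇒ (ExFree-sub s a) (ExFree-sub s b)
ExFree-sub s (ef-∀ a) = ef-∀ (ExFree-sub (extS s) a)
ExFree-sub s (ef-∀∈ a) = ef-∀∈ (ExFree-sub (extS s) a)
ExFree-sub s (ef-∃∈ a) = ef-∃∈ (ExFree-sub (extS s) a)

ExFree-ren : ∀ {Γ Δ} (r : Ren Γ Δ) {A : Fm Γ} → ExFree A → ExFree (renF r A)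
ExFree-ren r {A} a = subst ExFree (sym (renF-sub r A)) (ExFree-sub _ a)

HypWitnesses : ∀ {Γ} → List (Fm Γ) → Ctx → Set
HypWitnesses [] Γ' = ⊤
HypWitnesses (D ∷ Δ) Γ' = Tms Γ' (W D) × HypWitnesses Δ Γ'

HRsHyps : ∀ {Γ Γ'} (Δ : List (Fm Γ)) → Sub Γ Γ' → HypWitnesses Δ Γ' → List (Fm Γ')
HRsHyps [] σ tt = []
HRsHyps (D ∷ Δ) σ (d , ds) = HRs D σ d ∷ HRsHyps Δ σ ds

HRsHyps-∈ : ∀ {Γ Γ'} {Δ : List (Fm Γ)} {A} → A ∈ᴸ Δ → (σ : Sub Γ Γ') (ds : HypWitnesses Δ Γ') → Σ (Tms Γ' (W A)) (λ a → HRs A σ a ∈ᴸ HRsHyps Δ σ ds)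
HRsHyps-∈ (here refl) σ (d , ds) = d , here refl
HRsHyps-∈ (there p) σ (d , ds) with HRsHyps-∈ p σ ds
... | a , q = a , there q

renHypWitnesses : ∀ {Γ Γ' Γ''} (Δ : List (Fm Γ)) (r : Ren Γ' Γ'') → HypWitnesses Δ Γ' → HypWitnesses Δ Γ''
renHypWitnesses [] r tt = tt
renHypWitnesses (D ∷ Δ) r (d , ds) = renTms r d , renHypWitnesses Δ r ds

HRsHyps-ren : ∀ {Γ Γ' Γ''} (Δ : List (Fm Γ)) (σ : Sub Γ Γ') (r : Ren Γ' Γ'') (ds : HypWitnesses Δ Γ')
            → HRsHyps Δ (λ v → renT r (σ v)) (renHypWitnesses Δ r ds) ≡ map (renF r) (HRsHyps Δ σ ds)
HRsHyps-ren [] σ r tt = refl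
HRsHyps-ren (D ∷ Δ) σ r (d , ds) = cong₂ _∷_ (sym (renF-HRs D σ r d)) (HRsHyps-ren Δ σ r ds)

wkHypWitnesses : ∀ {Γ Γ' ρ} (Δ : List (Fm Γ)) → HypWitnesses Δ Γ' → HypWitnesses (map (wkF {σ = ρ}) Δ) (ρ ∷ Γ')
wkHypWitnesses [] tt = tt
wkHypWitnesses (D ∷ Δ) (d , ds) = castT (W-ren there D) (renTms there d) , wkHypWitnesses Δ ds

HRsHyps-wk : ∀ {Γ Γ' ρ} (Δ : List (Fm Γ)) (σ : Sub Γ Γ') (ds : HypWitnesses Δ Γ')
           → HRsHyps (map wkF Δ) (extS {σ = ρ} σ) (wkHypWitnesses Δ ds) ≡ map wkF (HRsHyps Δ σ ds)
HRsHyps-wk [] σ tt = refl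
HRsHyps-wk (D ∷ Δ) σ (d , ds) = cong₂ _∷_
  (trans (HRs-renF there D (extS σ) _ _ (castT-TEq (W-ren there D) (renTms there d))) (sym (renF-HRs D σ there d)))
  (HRsHyps-wk Δ σ ds)



module Realizers (T : Fm [] → Set) where
  open Unions T public

  HRs-⇒I : ∀ {Γ Γ'} (A B : Fm Γ) (σ : Sub Γ Γ') {H : List (Fm Γ')} (b : Tms (extCtx Γ' (W A)) (W B))
         → (HRs A (wkS* (W A) σ) (vars* (W A)) ∷ map (renF (wk* (W A))) H) ⊢ HRs B (wkS* (W A) σ) b
         → H ⊢ HRs (A ⇒ᶠ B) σ (lams* (W A) (W B) b)
  HRs-⇒I A B σ b d = ∀*I (W A) _ (⇒I (HRs-eqT B (EqT-sym (appAll-lams* (W A) (W B) b)) d))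

  HRs-⇒E : ∀ {Γ Γ'} (A B : Fm Γ) (σ : Sub Γ Γ') {H : List (Fm Γ')} (U : Tms Γ' (W (A ⇒ᶠ B))) (a : Tms Γ' (W A))
         → H ⊢ HRs (A ⇒ᶠ B) σ U → H ⊢ HRs A σ a → H ⊢ HRs B σ (appAll (W A) (W B) U a)
  HRs-⇒E A B σ U a d e = ⇒E (cast⊢ (cong₂ _⇒ᶠ_ eA eB) (∀*E0 (W A) _ d a)) e
    where
    θ = appendS (W A) var a
    eA : subF θ (HRs A (wkS* (W A) σ) (vars* (W A))) ≡ HRs A σ a
    eA = trans (subF-HRs A _ θ _) (trans (cong (HRs A _) (appendS-vars* (W A) var a)) (HRs-cong A (wkS*-appendS (W A) σ a) a))
    eB : subF θ (HRs B (wkS* (W A) σ) (appAll (W A) (W B) (renTms (wk* (W A)) U) (vars* (W A)))) ≡ HRs B σ (appAll (W A) (W B) U a)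
    eB = trans (subF-HRs B _ θ _) (trans (cong (HRs B _)
           (trans (appAll-sub θ (W A) (W B) _ _) (cong₂ (appAll (W A) (W B)) (appendS-wkTms (W A) a U) (appendS-vars* (W A) var a))))
           (HRs-cong B (wkS*-appendS (W A) σ a) _))

  HRs-∧I : ∀ {Γ Γ'} (A B : Fm Γ) (σ : Sub Γ Γ') {H : List (Fm Γ')} (a : Tms Γ' (W A)) (b : Tms Γ' (W B))
         → H ⊢ HRs A σ a → H ⊢ HRs B σ b → H ⊢ HRs (A ∧ᶠ B) σ (a ++ₜ b)
  HRs-∧I A B σ a b d e rewrite splitTms-++ₜ (W A) (W B) a b = ∧I d e

  ExFree-realized : ∀ {Γ Γ'} {A : Fm Γ} → ExFree A → (σ : Sub Γ Γ') {H : List (Fm Γ')} → H ⊢ subF σ A → Σ (Tms Γ' (W A)) (λ a → H ⊢ HRs A σ a)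
  ExFree-realized {A = A} ef σ d = defaultTms (W A) , cast⊢ (sym (ExFree-HRs ef σ _)) d

  HRs-∨I₁ : ∀ {Γ Γ'} (A B : Fm Γ) (σ : Sub Γ Γ') {H : List (Fm Γ')} (a : Tms Γ' (W A))
          → H ⊢ HRs A σ a → H ⊢ HRs (A ∨ᶠ B) σ (a ++ₜ defaultTms (W B))
  HRs-∨I₁ A B σ a d rewrite splitTms-++ₜ (W A) (W B) a (defaultTms (W B)) = ∨I₁ _ d

  HRs-∨I₂ : ∀ {Γ Γ'} (A B : Fm Γ) (σ : Sub Γ Γ') {H : List (Fm Γ')} (b : Tms Γ' (W B))
          → H ⊢ HRs B σ b → H ⊢ HRs (A ∨ᶠ B) σ (defaultTms (W A) ++ₜ b)
  HRs-∨I₂ A B σ b d rewrite splitTms-++ₜ (W A) (W B) (defaultTms (W A)) b = ∨I₂ _ d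

  HRs-∃I : ∀ {Γ Δ κ} {H : List (Fm Δ)} (Φ : Fm (κ ∷ Γ)) (σ : Sub Γ Δ) (Y : Tm Δ κ) (Ws : Tms Δ (W Φ))
         → H ⊢ HRs Φ (σ ,ˢ Y) Ws → H ⊢ HRs (∃ᶠ κ Φ) σ ((`s κ · Y) ∷ₜ Ws)
  HRs-∃I Φ σ Y Ws d = ∃∈I _ Y (s-mem Y)
    (cast⊢ (sym (trans (subF-HRs Φ (extS σ) (sub0S Y) _) (trans (cong (HRs Φ _) (sub0-wkTms Y Ws)) (HRs-cong Φ (extS-sub0-,ˢ σ Y) Ws)))) d)

  Realized : ∀ {Γ} → Fm Γ → Set
  Realized {Γ} A = ∀ {Γ'} (σ : Sub Γ Γ') → Σ (Tms Γ' (W A)) (λ a → [] ⊢ HRs A σ a)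


-- For atomic Q, W (Q ⇒ᶠ A) is map ([] ⇛_) (W A), which equals W A only after induction on W A.
toNil : ∀ {Γ} us → Tms Γ us → Tms Γ (map ([] ⇛_) us)
toNil [] []ₜ = []ₜ
toNil (u ∷ us) (x ∷ₜ xs) = x ∷ₜ toNil us xs

fromNil : ∀ {Γ} us → Tms Γ (map ([] ⇛_) us) → Tms Γ us
fromNil [] []ₜ = []ₜ
fromNil (u ∷ us) (x ∷ₜ xs) = x ∷ₜ fromNil us xs

fromNil-toNil : ∀ {Γ} us (xs : Tms Γ us) → fromNil us (toNil us xs) ≡ xs
fromNil-toNil [] []ₜ = refl
fromNil-toNil (u ∷ us) (x ∷ₜ xs) = cong (x ∷ₜ_) (fromNil-toNil us xs)

appAll-nil : ∀ {Γ} us (Us : Tms Γ (map ([] ⇛_) us)) → appAll [] us (renTms (wk* []) Us) []ₜ ≡ fromNil us Us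
appAll-nil [] []ₜ = refl
appAll-nil (u ∷ us) (U ∷ₜ Us) = cong₂ _∷ₜ_ (renT-id U) (appAll-nil us Us)

mapNil : ∀ {Γ ρ} us → Tms Γ (map (ρ ⇒_) (map ([] ⇛_) us)) → Tms Γ (map (ρ ⇒_) us)
mapNil [] []ₜ = []ₜ
mapNil (u ∷ us) (x ∷ₜ xs) = x ∷ₜ mapNil us xs

fromNil-appVar0 : ∀ {Γ ρ} us (V : Tms Γ (map (ρ ⇒_) (map ([] ⇛_) us))) → fromNil us (appVar0 (map ([] ⇛_) us) V) ≡ appVar0 us (mapNil us V)
fromNil-appVar0 [] []ₜ = refl
fromNil-appVar0 (u ∷ us) (x ∷ₜ xs) = cong (_ ∷ₜ_) (fromNil-appVar0 us xs)

HRs-∈⇒ : ∀ {Γ Δ ρ} (t : Tm Γ (ρ *)) (A : Fm (ρ ∷ Γ)) (τ : Sub Γ Δ) (Us : Tms (ρ ∷ Δ) (W ((var here ∈ᶠ wkT t) ⇒ᶠ A)))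
       → HRs ((var here ∈ᶠ wkT t) ⇒ᶠ A) (extS τ) Us ≡ ((var here ∈ᶠ wkT (subT τ t)) ⇒ᶠ HRs A (extS τ) (fromNil (W A) Us))
HRs-∈⇒ t A τ Us = cong₂ _⇒ᶠ_ (cong (var here ∈ᶠ_) (trans (subT-cong (λ v → renT-id (extS τ v)) (wkT t)) (subT-wkT τ t)))
  (trans (HRs-cong A (λ v → renT-id (extS τ v)) _) (cong (HRs A (extS τ)) (appAll-nil (W A) Us)))


module BoundedQuantifierAxioms (T : Fm [] → Set) where
  open Realizers T public

  ball-realized : ∀ {Γ ρ} (t : Tm Γ (ρ *)) (A : Fm (ρ ∷ Γ)) → Realized (∀∈ ρ t A ⇔ᶠ ∀ᶠ ρ (var here ∈ᶠ wkT t ⇒ᶠ A))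
  ball-realized {Γ} {ρ} t A {Γ'} σ = (u1 ++ₜ u2) , HRs-∧I (P1 ⇒ᶠ P2) (P2 ⇒ᶠ P1) σ u1 u2 (HRs-⇒I P1 P2 σ b1 D1) (HRs-⇒I P2 P1 σ b2 D2)
    where
    Q = var here ∈ᶠ wkT t
    P1 = ∀∈ ρ t A
    P2 = ∀ᶠ ρ (Q ⇒ᶠ A)
    σ1 = wkS* (W A) σ
    V1 = vars* (W A)
    b1 = lams (map ([] ⇛_) (W A)) (toNil (W A) (renTms there V1))
    u1 = lams* (W P1) (W P2) b1
    body : (var here ∈ᶠ wkT (subT σ1 t)) ∷ map wkF (HRs P1 σ1 V1 ∷ []) ⊢ HRs A (extS σ1) (renTms there V1)
    body = cast⊢ (inst-var0 _) (∀∈E (hyp (there (here refl))) (var here) (hyp (here refl)))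
    D1 : HRs P1 σ1 V1 ∷ [] ⊢ HRs P2 σ1 b1
    D1 = ∀I (HRs-eqT (Q ⇒ᶠ A) (EqT-sym (appVar0-lams _ _))
           (cast⊢ (sym (HRs-∈⇒ t A σ1 _)) (⇒I (cast⊢ (cong (HRs A (extS σ1)) (sym (fromNil-toNil (W A) _))) body))))
    σ2 = wkS* (W P2) σ
    V2 = vars* (W P2)
    b2 = ⋃̂s (W A) (subT σ2 t) (mapNil (W A) V2)
    u2 = lams* (W P2) (W P1) b2
    E : (var here ∈ᶠ wkT (subT σ2 t)) ∷ map wkF (HRs P2 σ2 V2 ∷ []) ⊢ HRs A (extS σ2) (appVar0 (W A) (mapNil (W A) V2))
    E = cast⊢ (cong (HRs A (extS σ2)) (fromNil-appVar0 (W A) V2))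
          (⇒E (cast⊢ (HRs-∈⇒ t A σ2 _) (wk1 (∀unpack (hyp (here refl))))) (hyp (here refl)))
    -- The candidates produced for the various z ∈ t are merged by ⋃̂ over t.
    D2 : HRs P2 σ2 V2 ∷ [] ⊢ HRs P1 σ2 b2
    D2 = ∀∈I (HRs-mono A (extS σ2) (⊑Tms-⋃-var0 (W A) (subT σ2 t) (mapNil (W A) V2) (hyp (here refl))) E)

  bex-realized : ∀ {Γ ρ} (t : Tm Γ (ρ *)) (A : Fm (ρ ∷ Γ)) → Realized (∃∈ ρ t A ⇔ᶠ ∃ᶠ ρ (var here ∈ᶠ wkT t ∧ᶠ A))
  bex-realized {Γ} {ρ} t A {Γ'} σ = (u1 ++ₜ u2) , HRs-∧I (P1 ⇒ᶠ P2) (P2 ⇒ᶠ P1) σ u1 u2 (HRs-⇒I P1 P2 σ b1 D1) (HRs-⇒I P2 P1 σ b2 D2)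
    where
    Q = var here ∈ᶠ wkT t
    P1 = ∃∈ ρ t A
    P2 = ∃ᶠ ρ (Q ∧ᶠ A)
    σ1 = wkS* (W A) σ
    V1 = vars* (W A)
    b1 : Tms (extCtx Γ' (W A)) (W P2)
    b1 = subT σ1 t ∷ₜ V1
    u1 = lams* (W P1) (W P2) b1
    D1 : HRs P1 σ1 V1 ∷ [] ⊢ HRs P2 σ1 b1
    D1 = ∃∈E (hyp (here refl)) (∃∈I _ (var here) (hyp (here refl))
           (cast⊢ (sym (inst-var0 _)) (∧I (cast⊢ (cong (var here ∈ᶠ_) (sym (subT-wkT σ1 t))) (hyp (here refl))) (hyp (there (here refl))))))
    σ2 = wkS* (W P2) σ
    b2 : Tms (extCtx Γ' (W P2)) (W A)
    b2 = vars* (W A)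
    u2 = lams* (W P2) (W P1) b2
    D2 : HRs P2 σ2 (vars* (W P2)) ∷ [] ⊢ HRs P1 σ2 b2
    D2 = ∃∈E (hyp (here refl)) (∃∈I _ (var here) (cast⊢ (cong (var here ∈ᶠ_) (subT-wkT σ2 t)) (∧E₁ (hyp (there (here refl)))))
           (cast⊢ (sym (inst-var0 _)) (∧E₂ (hyp (there (here refl))))))


module ChoiceAxioms (T : Fm [] → Set) where
  open BoundedQuantifierAxioms T public

  -- A realizer of ∀x ∃y A already is a set-valued choice function, so AC is realized by the identity.
  AC-realized : ∀ {Γ} ρ κ (A : Fm (κ ∷ ρ ∷ Γ)) → Realized (AC ρ κ A)
  AC-realized {Γ} ρ κ A {Γ'} σ = lams* (W P) (W Q) b , HRs-⇒I P Q σ b D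
    where
    A' = renF acRen A
    P = ∀ᶠ ρ (∃ᶠ κ A)
    Φ = ∀ᶠ ρ (∃∈ κ (var (there here) · var here) A')
    Q = ∃ᶠ (ρ ⇒ κ *) Φ
    σ1 = wkS* (W P) σ
    Y : Tm (extCtx Γ' (W P)) (ρ ⇒ κ *)
    Y = var (wk* (map (ρ ⇒_) (W A)) here)
    Xs = vars* (map (ρ ⇒_) (W A))
    Xs' = castT (cong (map (ρ ⇒_)) (W-ren acRen A)) Xs
    b : Tms (extCtx Γ' (W P)) (W Q)
    b = (`s (ρ ⇒ κ *) · Y) ∷ₜ Xs'
    pw : (λ {τ} (v : (κ ∷ ρ ∷ Γ) ∋ τ) → extS (extS (σ1 ,ˢ Y)) (acRen v)) ≗ˢ extS (extS σ1)
    pw here = refl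
    pw (there here) = refl
    pw (there (there v)) = refl
    eqA : HRs A (extS (extS σ1)) (renTms there (appVar0 (W A) Xs)) ≡ HRs A' (extS (extS (σ1 ,ˢ Y))) (renTms there (appVar0 (W A') Xs'))
    eqA = sym (trans (HRs-renF acRen A (extS (extS (σ1 ,ˢ Y))) _ _
                        (renTms-TEq there (appVar0-TEq (W A') (W A) (W-ren acRen A) (castT-TEq _ Xs))))
                     (HRs-cong A pw _))
    D : HRs P σ1 (vars* (W P)) ∷ [] ⊢ HRs Q σ1 b
    D = HRs-∃I Φ σ1 Y Xs' (cast⊢ (cong (λ z → ∀ᶠ ρ (∃∈ κ (wkT Y · var here) z)) eqA) (hyp (here refl)))

  -- B is ∃-free, so its realizers are irrelevant: the candidate set w is obtained by applying the
  -- realizers of B → ∃y A to default arguments.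
  IP-realized : ∀ {Γ} κ (B : Fm Γ) → ExFree B → (A : Fm (κ ∷ Γ)) → Realized (IP κ B A)
  IP-realized {Γ} κ B efB A {Γ'} σ = lams* (W P) (W Q) b , HRs-⇒I P Q σ b D
    where
    A' = renF ipRen A
    P = B ⇒ᶠ ∃ᶠ κ A
    Φ = wkF B ⇒ᶠ ∃∈ κ (var here) A'
    Q = ∃ᶠ (κ *) Φ
    Γ1 = extCtx Γ' (W P)
    σ1 = wkS* (W P) σ
    Y : Tm Γ1 (W B ⇛ (κ *))
    Y = var (wk* (map (W B ⇛_) (W A)) here)
    Xs = vars* (map (W B ⇛_) (W A))
    c0 = defaultTms (W B)
    Y0 = appTms Y c0
    XA = appAll (W B) (W A) Xs c0
    g0 : HRs P σ1 (vars* (W P)) ∷ [] ⊢ HRs B σ1 c0 ⇒ᶠ ∃∈ κ Y0 (HRs A (extS σ1) (renTms there XA))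
    g0 = ⇒I (HRs-⇒E B (∃ᶠ κ A) σ1 (Y ∷ₜ Xs) c0 (wk1 (hyp (here refl))) (hyp (here refl)))
    τ : Sub (κ * ∷ Γ) Γ1
    τ = σ1 ,ˢ Y0
    wsB = W (wkF {σ = κ *} B)
    r = wk* {Γ1} wsB
    b' : Tms (extCtx Γ1 wsB) (W A')
    b' = castT (W-ren ipRen A) (renTms r XA)
    eqB : HRs (wkF B) (wkS* wsB τ) (vars* wsB) ≡ renF r (HRs B σ1 c0)
    eqB = trans (ExFree-HRs (ExFree-ren there efB) _ _) (trans (subF-renF there _ B)
            (sym (trans (cong (renF r) (ExFree-HRs efB σ1 c0)) (renF-subF σ1 r B))))
    pw1 : (λ {τ'} (v : (κ ∷ Γ) ∋ τ') → renT (extR r) (extS σ1 v)) ≗ˢ (λ v → extS (wkS* wsB τ) (ipRen v))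
    pw1 here = refl
    pw1 (there u) = trans (renT-renT there (extR r) (σ1 u)) (sym (renT-renT r there (σ1 u)))
    tupEq : renTms (extR r) (renTms there XA) ≡ renTms there (renTms r XA)
    tupEq = trans (renTms-renTms there (extR r) XA) (sym (renTms-renTms r there XA))
    eqT : renF r (∃∈ κ Y0 (HRs A (extS σ1) (renTms there XA))) ≡ HRs (∃∈ κ (var here) A') (wkS* wsB τ) b'
    eqT = cong (∃∈ κ (renT r Y0)) (trans (renF-HRs A (extS σ1) (extR r) _) (trans (HRs-cong A pw1 _) (trans (cong (HRs A _) tupEq)
            (sym (HRs-renF ipRen A (extS (wkS* wsB τ)) (renTms there b') (renTms there (renTms r XA))
                   (renTms-TEq there (castT-TEq (W-ren ipRen A) (renTms r XA))))))))
    Dinner : HRs (wkF B) (wkS* wsB τ) (vars* wsB) ∷ map (renF r) (HRs P σ1 (vars* (W P)) ∷ []) ⊢ HRs (∃∈ κ (var here) A') (wkS* wsB τ) b'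
    Dinner = cast⊢ eqT (⇒E (wk1 (renH r g0)) (cast⊢ eqB (hyp (here refl))))
    Ws = lams* wsB (W A') b'
    D : HRs P σ1 (vars* (W P)) ∷ [] ⊢ HRs Q σ1 ((`s (κ *) · Y0) ∷ₜ Ws)
    D = HRs-∃I Φ σ1 Y0 Ws (HRs-⇒I (wkF B) (∃∈ κ (var here) A') τ b' Dinner)
    b = (`s (κ *) · Y0) ∷ₜ Ws


appT : ∀ {Δ ρ} us → Tms Δ (map (ρ ⇒_) us) → Tm Δ ρ → Tms Δ us
appT [] []ₜ t = []ₜ
appT (u ∷ us) (X ∷ₜ Xs) t = (X · t) ∷ₜ appT us Xs t

appT-sub : ∀ {Δ Δ' ρ} us (s : Sub Δ Δ') (Xs : Tms Δ (map (ρ ⇒_) us)) (t : Tm Δ ρ) → subTms s (appT us Xs t) ≡ appT us (subTms s Xs) (subT s t)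
appT-sub [] s []ₜ t = refl
appT-sub (u ∷ us) s (X ∷ₜ Xs) t = cong (_ ∷ₜ_) (appT-sub us s Xs t)

appVar0-appT : ∀ {Δ ρ} us (Xs : Tms Δ (map (ρ ⇒_) us)) → appVar0 us Xs ≡ appT us (renTms there Xs) (var here)
appVar0-appT [] []ₜ = refl
appVar0-appT (u ∷ us) (X ∷ₜ Xs) = cong (_ ∷ₜ_) (appVar0-appT us Xs)

sub0-appVar0 : ∀ {Δ ρ} us (Xs : Tms Δ (map (ρ ⇒_) us)) (t : Tm Δ ρ) → subTms (sub0S t) (appVar0 us Xs) ≡ appT us Xs t
sub0-appVar0 us Xs t = trans (cong (subTms (sub0S t)) (appVar0-appT us Xs)) (trans (appT-sub us (sub0S t) _ _) (cong (λ z → appT us z t) (sub0-wkTms t Xs)))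


module Recursion (T : Fm [] → Set) where
  open ChoiceAxioms T public

  -- Xs satisfies Xs 0 = x0 and Xs (S n) = Us n (Xs n). As R recurses at a single type, each component
  -- is the continuation Y n : (ws ⇛ ρ) ⇒ ρ, with Y 0 h = h x0 and Y (S n) h = Y n (λ xs → h (Us n xs)),
  -- applied to a projection.
  module SimultaneousRecursion {Θ : Ctx} (ws : List Ty) (x0 : Tms Θ ws) (Us : Tms Θ (map (N ⇒_) (map (ws ⇛_) ws))) where

    Cont : Ty → Ty
    Cont ρ = (ws ⇛ ρ) ⇒ ρ

    cont-zero : ∀ ρ → Tm Θ (Cont ρ)
    cont-zero ρ = lam (appTms (var here) (renTms there x0))

    StepCtx : Ty → Ctx
    StepCtx ρ = (ws ⇛ ρ) ∷ N ∷ Cont ρ ∷ Θ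

    wkStepCtx : ∀ {ρ} → Ren Θ (StepCtx ρ)
    wkStepCtx v = there (there (there v))

    stepBody : ∀ ρ → Tm (extCtx (StepCtx ρ) ws) ρ
    stepBody ρ = appTms (renT (wk* ws) (var here)) (appAll ws ws (renTms (wk* ws) (appT (map (ws ⇛_) ws) (renTms wkStepCtx Us) (var (there here)))) (vars* ws))

    cont-suc : ∀ ρ → Tm Θ (Cont ρ ⇒ N ⇒ Cont ρ)
    cont-suc ρ = lam (lam (lam (var (there (there here)) · lam* ws (stepBody ρ))))

    projections : Tms Θ (map (ws ⇛_) ws)
    projections = lams* ws ws (vars* ws)

    component : ∀ {u} → Tm Θ (ws ⇛ u) → Tm Θ (N ⇒ u)
    component {u} p = lam (`R (Cont u) · var here · wkT (cont-zero u) · wkT (cont-suc u) · wkT p)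

    components : ∀ us → Tms Θ (map (ws ⇛_) us) → Tms Θ (map (N ⇒_) us)
    components [] []ₜ = []ₜ
    components (u ∷ us) (p ∷ₜ ps) = component p ∷ₜ components us ps

    Xs : Tms Θ (map (N ⇒_) ws)
    Xs = components ws projections

    Y : ∀ {Δ} ρ (σ : Sub Θ Δ) (t : Tm Δ N) → Tm Δ (Cont ρ)
    Y ρ σ t = `R (Cont ρ) · t · subT σ (cont-zero ρ) · subT σ (cont-suc ρ)

    component-β : ∀ {Δ u} {H : List (Fm Δ)} (σ : Sub Θ Δ) (p : Tm Θ (ws ⇛ u)) (t : Tm Δ N)
                → H ⊢ subT σ (component p) · t ≐ Y u σ t · subT σ p
    component-β {u = u} σ p t = cast⊢ (cong (λ z → subT σ (component p) · t ≐ z)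
        (trans (cong₂ (λ a b → `R (Cont u) · t · a · b · subT (σ ,ˢ t) (wkT p)) (subT-,ˢ-wkT σ t (cont-zero u)) (subT-,ˢ-wkT σ t (cont-suc u)))
               (cong (Y u σ t ·_) (subT-,ˢ-wkT σ t p))))
      (lam-β σ t (`R (Cont u) · var here · wkT (cont-zero u) · wkT (cont-suc u) · wkT p))

    cont-zero-β : ∀ {Δ ρ} {H : List (Fm Δ)} (σ : Sub Θ Δ) (h : Tm Δ (ws ⇛ ρ)) → H ⊢ subT σ (cont-zero ρ) · h ≐ appTms h (subTms σ x0)
    cont-zero-β {ρ = ρ} σ h = cast⊢ (cong (λ z → subT σ (cont-zero ρ) · h ≐ z) (trans (appTms-sub (σ ,ˢ h) (var here) (renTms there x0))
                     (cong (appTms h) (trans (subTms-renTms there _ x0) (subTms-cong (λ v → refl) x0)))))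
      (lam-β σ h (appTms (var here) (renTms there x0)))

    stepS : ∀ {Δ ρ} (σ : Sub Θ Δ) (t : Tm Δ N) (h : Tm Δ (ws ⇛ ρ)) → Sub (StepCtx ρ) Δ
    stepS {ρ = ρ} σ t h = ((σ ,ˢ Y ρ σ t) ,ˢ t) ,ˢ h

    Y-suc : ∀ {Δ ρ} {H : List (Fm Δ)} (σ : Sub Θ Δ) (t : Tm Δ N) (h : Tm Δ (ws ⇛ ρ))
          → H ⊢ Y ρ σ (`S · t) · h ≐ Y ρ σ t · subT (stepS σ t h) (lam* ws (stepBody ρ))
    Y-suc {ρ = ρ} σ t h =
      ≐trans (·-cong (haax (RS t (subT σ (cont-zero ρ)) (subT σ (cont-suc ρ)))) (≐refl h))
      (≐trans (·-cong (·-cong (lam-β σ (Y ρ σ t) (lam (lam B0))) (≐refl t)) (≐refl h))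
      (≐trans (·-cong (lam-β (σ ,ˢ Y ρ σ t) t (lam B0)) (≐refl h))
        (lam-β ((σ ,ˢ Y ρ σ t) ,ˢ t) h B0)))
      where
      B0 : Tm (StepCtx ρ) ρ
      B0 = var (there (there here)) · lam* ws (stepBody ρ)

    Step : ∀ {Δ} (σ : Sub Θ Δ) (t : Tm Δ N) (Xt : Tms Δ ws) → Tms Δ ws
    Step σ t Xt = appAll ws ws (appT (map (ws ⇛_) ws) (subTms σ Us) t) Xt

    stepBody-β : ∀ {Δ ρ} {H : List (Fm Δ)} (σ : Sub Θ Δ) (t : Tm Δ N) (h : Tm Δ (ws ⇛ ρ)) (xs : Tms Δ ws)
               → H ⊢ appTms (subT (stepS σ t h) (lam* ws (stepBody ρ))) xs ≐ appTms h (Step σ t xs)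
    stepBody-β {Δ} {ρ} σ t h xs =
      cast⊢ (cong (λ z → appTms (subT θ (lam* ws (stepBody ρ))) xs ≐ z) body≡) (lam*-β ws θ (stepBody ρ) xs)
      where
      θ : Sub (StepCtx ρ) Δ
      θ = stepS σ t h
      Us-at : Tms (StepCtx ρ) (map (ws ⇛_) ws)
      Us-at = appT (map (ws ⇛_) ws) (renTms wkStepCtx Us) (var (there here))
      Us-at≡ : subTms (appendS ws θ xs) (renTms (wk* ws) Us-at) ≡ appT (map (ws ⇛_) ws) (subTms σ Us) t
      Us-at≡ = trans (subTms-renTms (wk* ws) _ Us-at) (trans (subTms-cong (appendS-wk* ws θ xs) Us-at)
        (trans (appT-sub (map (ws ⇛_) ws) θ (renTms wkStepCtx Us) (var (there here)))
          (cong (λ z → appT (map (ws ⇛_) ws) z t) (trans (subTms-renTms wkStepCtx θ Us) (subTms-cong (λ v → refl) Us)))))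
      body≡ : subT (appendS ws θ xs) (stepBody ρ) ≡ appTms h (Step σ t xs)
      body≡ = trans (appTms-sub _ (renT (wk* ws) (var here)) (appAll ws ws (renTms (wk* ws) Us-at) (vars* ws)))
        (cong₂ appTms (appendS-wk* ws θ xs here)
          (trans (appAll-sub _ ws ws (renTms (wk* ws) Us-at) (vars* ws)) (cong₂ (appAll ws ws) Us-at≡ (appendS-vars* ws θ xs))))

    projections-β : ∀ {Δ} {H : List (Fm Δ)} (σ : Sub Θ Δ) (xs : Tms Δ ws) → EqT H (appAll ws ws (subTms σ projections) xs) xs
    projections-β σ xs = EqT-trans (lams*-β ws ws σ (vars* ws) xs) (EqT-≡ (appendS-vars* ws σ xs))

    -- Y t h = h (Xs t). Deriving Xs (S t) = Us t (Xs t) needs this for all h at once, hence by induction on t.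
    ContSpec : ∀ {Δ} u (t : Tm Δ N) (b : Tm Δ (Cont u)) (s : Tm Δ (Cont u ⇒ N ⇒ Cont u)) (Xt : Tms Δ ws) → Fm Δ
    ContSpec u t b s Xt = ∀ᶠ (ws ⇛ u) (`R (Cont u) · wkT t · wkT b · wkT s · var here ≐ appTms (var here) (renTms there Xt))

    ContSpecs : ∀ {Δ} (σ : Sub Θ Δ) (us : List Ty) (t : Tm Δ N) (Xt : Tms Δ ws) → Fm Δ
    ContSpecs σ [] t Xt = `0 ≐ `0
    ContSpecs σ (u ∷ us) t Xt = ContSpec u t (subT σ (cont-zero u)) (subT σ (cont-suc u)) Xt ∧ᶠ ContSpecs σ us t Xt

    ContSpec-sub : ∀ {Δ Δ'} u (s' : Sub Δ Δ') (t : Tm Δ N) b s (Xt : Tms Δ ws)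
                 → subF s' (ContSpec u t b s Xt) ≡ ContSpec u (subT s' t) (subT s' b) (subT s' s) (subTms s' Xt)
    ContSpec-sub u s' t b s Xt = cong (∀ᶠ (ws ⇛ u)) (cong₂ _≐_
      (cong₂ (λ x y → x · y · var here) (cong₂ (λ x y → `R (Cont u) · x · y) (subT-wkT s' t) (subT-wkT s' b)) (subT-wkT s' s))
      (trans (appTms-sub (extS s') (var here) (renTms there Xt)) (cong (appTms (var here)) (subTms-wk s' Xt))))

    ContSpecs-sub : ∀ {Δ Δ'} (σ : Sub Θ Δ) (s' : Sub Δ Δ') (us : List Ty) (t : Tm Δ N) (Xt : Tms Δ ws)
                  → subF s' (ContSpecs σ us t Xt) ≡ ContSpecs (σ ⨾ s') us (subT s' t) (subTms s' Xt)
    ContSpecs-sub σ s' [] t Xt = refl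
    ContSpecs-sub σ s' (u ∷ us) t Xt = cong₂ _∧ᶠ_
      (trans (ContSpec-sub u s' t (subT σ (cont-zero u)) (subT σ (cont-suc u)) Xt) (cong₂ (λ a b → ContSpec u (subT s' t) a b (subTms s' Xt)) (subT-subT σ s' (cont-zero u)) (subT-subT σ s' (cont-suc u))))
      (ContSpecs-sub σ s' us t Xt)

    ContSpecs-cong : ∀ {Δ} {σ σ' : Sub Θ Δ} → σ ≗ˢ σ' → ∀ (us : List Ty) (t : Tm Δ N) (Xt : Tms Δ ws) → ContSpecs σ us t Xt ≡ ContSpecs σ' us t Xt
    ContSpecs-cong e [] t Xt = refl
    ContSpecs-cong e (u ∷ us) t Xt = cong₂ _∧ᶠ_ (cong₂ (λ a b → ContSpec u t a b Xt) (subT-cong e (cont-zero u)) (subT-cong e (cont-suc u))) (ContSpecs-cong e us t Xt)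

    ContSpec-apply : ∀ {Δ u} {H : List (Fm Δ)} {t b s} {Xt : Tms Δ ws} → H ⊢ ContSpec u t b s Xt → (L : Tm Δ (ws ⇛ u))
                   → H ⊢ `R (Cont u) · t · b · s · L ≐ appTms L Xt
    ContSpec-apply {t = t} {b} {s} {Xt} d L = cast⊢ (cong₂ _≐_
        (cong₂ (λ x y → x · y · L) (cong₂ (λ x y → `R _ · x · y) (sub0-wk L t) (sub0-wk L b)) (sub0-wk L s))
        (trans (appTms-sub (sub0S L) (var here) (renTms there Xt)) (cong (appTms L) (sub0-wkTms L Xt))))
      (∀E d L)

    components-zero : ∀ {Δ} {H : List (Fm Δ)} (σ : Sub Θ Δ) us (ps : Tms Θ (map (ws ⇛_) us))
                    → EqT H (appT us (subTms σ (components us ps)) `0) (appAll ws us (subTms σ ps) (subTms σ x0))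
    components-zero σ [] []ₜ = tt
    components-zero σ (u ∷ us) (p ∷ₜ ps) =
      ≐trans (component-β σ p `0) (≐trans (·-cong (haax (R0 _ _)) (≐refl _)) (cont-zero-β σ (subT σ p))) , components-zero σ us ps

    Xs-zero-sub : ∀ {Δ} {H : List (Fm Δ)} (σ : Sub Θ Δ) → EqT H (appT ws (subTms σ Xs) `0) (subTms σ x0)
    Xs-zero-sub σ = EqT-trans (components-zero σ ws projections) (projections-β σ (subTms σ x0))

    components-suc : ∀ {Δ} {H : List (Fm Δ)} (σ : Sub Θ Δ) us (ps : Tms Θ (map (ws ⇛_) us)) (t : Tm Δ N) (Xt : Tms Δ ws)
                   → H ⊢ ContSpecs σ us t Xt → EqT H (appT us (subTms σ (components us ps)) (`S · t)) (appAll ws us (subTms σ ps) (Step σ t Xt))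
    components-suc σ [] []ₜ t Xt d = tt
    components-suc σ (u ∷ us) (p ∷ₜ ps) t Xt d =
      ≐trans (component-β σ p (`S · t)) (≐trans (Y-suc σ t (subT σ p)) (≐trans (ContSpec-apply {Xt = Xt} (∧E₁ d) (subT (stepS σ t (subT σ p)) (lam* ws (stepBody u)))) (stepBody-β σ t (subT σ p) Xt)))
      , components-suc σ us ps t Xt (∧E₂ d)

    Xs-suc-sub : ∀ {Δ} {H : List (Fm Δ)} (σ : Sub Θ Δ) (t : Tm Δ N) → H ⊢ ContSpecs σ ws t (appT ws (subTms σ Xs) t)
               → EqT H (appT ws (subTms σ Xs) (`S · t)) (Step σ t (appT ws (subTms σ Xs) t))
    Xs-suc-sub σ t d = EqT-trans (components-suc σ ws projections t _ d) (projections-β σ _)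

    wkS : ∀ {Δ ρ} (σ : Sub Θ Δ) → Sub Θ (ρ ∷ Δ)
    wkS σ v = wkT (σ v)

    wkT-subT : ∀ {Δ ρ τ} (σ : Sub Θ Δ) (x : Tm Θ τ) → wkT {σ = ρ} (subT σ x) ≡ subT (wkS σ) x
    wkT-subT σ x = renT-subT σ there x

    wkTms-subTms : ∀ {Δ ρ us} (σ : Sub Θ Δ) (xs : Tms Θ us) → renTms (there {σ = ρ}) (subTms σ xs) ≡ subTms (wkS σ) xs
    wkTms-subTms σ xs = renTms-subTms σ there xs

    ContSpec-wk : ∀ {Δ ρ} u (t : Tm Δ N) b s (Xt : Tms Δ ws) → wkF {σ = ρ} (ContSpec u t b s Xt) ≡ ContSpec u (wkT t) (wkT b) (wkT s) (renTms there Xt)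
    ContSpec-wk u t b s Xt = trans (renF-sub there _) (trans (ContSpec-sub u _ t b s Xt)
      (sym (ContSpec-cong u (renT-sub there t) (renT-sub there b) (renT-sub there s) (renTms-sub there Xt))))
      where
      ContSpec-cong : ∀ {Δ} u {t t' : Tm Δ N} {b b' s s'} {X X' : Tms Δ ws} → t ≡ t' → b ≡ b' → s ≡ s' → X ≡ X' → ContSpec u t b s X ≡ ContSpec u t' b' s' X'
      ContSpec-cong u refl refl refl refl = refl

    Step-wk : ∀ {Δ ρ} (σ : Sub Θ Δ) (t : Tm Δ N) (Xt : Tms Δ ws) → renTms (there {σ = ρ}) (Step σ t Xt) ≡ Step (wkS σ) (wkT t) (renTms there Xt)
    Step-wk σ t Xt = trans (renTms-sub there _) (trans (appAll-sub _ ws ws _ Xt) (cong₂ (appAll ws ws)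
      (trans (appT-sub (map (ws ⇛_) ws) _ (subTms σ Us) t) (cong₂ (appT (map (ws ⇛_) ws)) (trans (sym (renTms-sub there _)) (wkTms-subTms σ Us)) (sym (renT-sub there t))))
      (sym (renTms-sub there Xt))))

    ContSpecs-zero : ∀ {Δ} {H : List (Fm Δ)} (σ : Sub Θ Δ) us → H ⊢ ContSpecs σ us `0 (appT ws (subTms σ Xs) `0)
    ContSpecs-zero σ [] = ≐refl `0
    ContSpecs-zero {H = H} σ (u ∷ us) = ∧I (∀I body) (ContSpecs-zero σ us)
      where
      body : map wkF H ⊢ `R (Cont u) · `0 · wkT (subT σ (cont-zero u)) · wkT (subT σ (cont-suc u)) · var here ≐ appTms (var here) (renTms there (appT ws (subTms σ Xs) `0))
      body = ≐trans (·-cong (haax (R0 _ _)) (≐refl _))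
        (≐trans (cast⊢ (cong₂ (λ a b → a · var here ≐ appTms (var here) b) (sym (wkT-subT σ (cont-zero u))) (sym (wkTms-subTms σ x0))) (cont-zero-β (wkS σ) (var here)))
          (appTms-congʳ (var here) (EqT-sym (EqT-wk (Xs-zero-sub σ)))))

    ContSpecs-suc : ∀ {Δ} {H : List (Fm Δ)} (σ : Sub Θ Δ) (t : Tm Δ N) us
                  → EqT H (appT ws (subTms σ Xs) (`S · t)) (Step σ t (appT ws (subTms σ Xs) t))
                  → H ⊢ ContSpecs σ us t (appT ws (subTms σ Xs) t) → H ⊢ ContSpecs σ us (`S · t) (appT ws (subTms σ Xs) (`S · t))
    ContSpecs-suc σ t [] xe d = ≐refl `0
    ContSpecs-suc {Δ} {H} σ t (u ∷ us) xe d = ∧I (∀I body) (ContSpecs-suc σ t us xe (∧E₂ d))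
      where
      Xt XSt : Tms Δ ws
      Xt = appT ws (subTms σ Xs) t
      XSt = appT ws (subTms σ Xs) (`S · t)
      h : Tm ((ws ⇛ u) ∷ Δ) (ws ⇛ u)
      h = var here
      L : Tm ((ws ⇛ u) ∷ Δ) (ws ⇛ u)
      L = subT (stepS (wkS σ) (wkT t) h) (lam* ws (stepBody u))
      ih : map wkF H ⊢ ContSpec u (wkT t) (subT (wkS σ) (cont-zero u)) (subT (wkS σ) (cont-suc u)) (renTms there Xt)
      ih = cast⊢ (trans (ContSpec-wk u t _ _ Xt) (cong₂ (λ a b → ContSpec u (wkT t) a b (renTms there Xt)) (wkT-subT σ (cont-zero u)) (wkT-subT σ (cont-suc u)))) (wkH (∧E₁ d))
      body : map wkF H ⊢ `R (Cont u) · (`S · wkT t) · wkT (subT σ (cont-zero u)) · wkT (subT σ (cont-suc u)) · var here ≐ appTms (var here) (renTms there XSt)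
      body = cast⊢ (cong₂ (λ a b → `R (Cont u) · (`S · wkT t) · a · b · var here ≐ appTms (var here) (renTms there XSt)) (sym (wkT-subT σ (cont-zero u))) (sym (wkT-subT σ (cont-suc u))))
        (≐trans (Y-suc (wkS σ) (wkT t) h) (≐trans (ContSpec-apply {Xt = renTms there Xt} ih L) (≐trans (stepBody-β (wkS σ) (wkT t) h (renTms there Xt))
          (cast⊢ (cong (λ z → appTms h z ≐ appTms h (renTms there XSt)) (Step-wk σ t Xt)) (appTms-congʳ h (EqT-sym (EqT-wk xe)))))))

    wk1S : Sub Θ (N ∷ Θ)
    wk1S v = var (there v)

    specs : Fm (N ∷ Θ)
    specs = ContSpecs wk1S ws (var here) (appT ws (subTms wk1S Xs) (var here))

    specs-zero : specs [ `0 ] ≡ ContSpecs var ws `0 (appT ws (subTms var Xs) `0)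
    specs-zero = trans (ContSpecs-sub wk1S (sub0S `0) ws _ _) (trans (ContSpecs-cong (λ v → refl) ws `0 _)
           (cong (ContSpecs var ws `0) (trans (appT-sub ws (sub0S `0) _ (var here)) (cong (λ z → appT ws z `0)
             (trans (subTms-subTms wk1S (sub0S `0) Xs) (subTms-cong (λ v → refl) Xs))))))

    specs-suc : subF sucS specs ≡ ContSpecs wk1S ws (`S · var here) (appT ws (subTms wk1S Xs) (`S · var here))
    specs-suc = trans (ContSpecs-sub wk1S sucS ws _ _) (trans (ContSpecs-cong (λ v → refl) ws _ _)
           (cong (ContSpecs wk1S ws (`S · var here)) (trans (appT-sub ws sucS _ (var here)) (cong (λ z → appT ws z (`S · var here))
             (trans (subTms-subTms wk1S sucS Xs) (subTms-cong (λ v → refl) Xs))))))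

    specs-all : [] ⊢ ∀ᶠ N specs
    specs-all = ⇒E (haax (ind specs)) (∧I (cast⊢ (sym specs-zero) (ContSpecs-zero var ws))
             (∀I (⇒I (cast⊢ (sym specs-suc) (ContSpecs-suc wk1S (var here) ws (Xs-suc-sub wk1S (var here) (hyp (here refl))) (hyp (here refl)))))))

    Xs-zero : ∀ {H : List (Fm Θ)} → EqT H (appT ws Xs `0) x0
    Xs-zero = subst₂ (EqT _) (cong (λ z → appT ws z `0) (subTms-id Xs)) (subTms-id x0) (Xs-zero-sub var)

    Xs-suc : ∀ {H : List (Fm (N ∷ Θ))} → EqT H (appT ws (subTms wk1S Xs) (`S · var here)) (Step wk1S (var here) (appT ws (subTms wk1S Xs) (var here)))
    Xs-suc = EqT-weak (λ ()) (Xs-suc-sub wk1S (var here) (∀unpack specs-all))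


module InductionAxiom (T : Fm [] → Set) where
  open Recursion T public

  castT-step-TEq : ∀ {Δ} ws us us' (p : us ≡ us') (vU : Tms Δ (map (N ⇒_) (map (ws ⇛_) us'))) (xs : Tms (N ∷ Δ) ws)
                 → TEq (appAll ws us' (appVar0 (map (ws ⇛_) us') vU) xs)
                       (appAll ws us (appVar0 (map (ws ⇛_) us) (castT (cong (λ l → map (N ⇒_) (map (ws ⇛_) l)) p) vU)) xs)
  castT-step-TEq ws us .us refl vU xs = TEq-refl _

  -- The realizer of ∀n A is defined by simultaneous recursion from those of A(0) and of the step,
  -- and it is verified by induction on A_HR(n, Xs n).
  ind-realized : ∀ {Γ} (A : Fm (N ∷ Γ)) → Realized ((A [ `0 ] ∧ᶠ ∀ᶠ N (A ⇒ᶠ subF sucS A)) ⇒ᶠ ∀ᶠ N A)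
  ind-realized {Γ} A {Γ'} σ = lams* (W P) (W Q) Xs , HRs-⇒I P Q σ Xs conclusion
    where
    A₀ : Fm Γ
    A₀ = A [ `0 ]
    A⁺ : Fm (N ∷ Γ)
    A⁺ = subF sucS A
    P Q : Fm Γ
    P = A₀ ∧ᶠ ∀ᶠ N (A ⇒ᶠ A⁺)
    Q = ∀ᶠ N A
    ws : List Ty
    ws = W A
    Γ₁ : Ctx
    Γ₁ = extCtx Γ' (W P)
    σ₁ : Sub Γ Γ₁
    σ₁ = wkS* (W P) σ
    v₀ : Tms Γ₁ (W A₀)
    v₀ = proj₁ (splitTms (W A₀) (map (N ⇒_) (map (W A ⇛_) (W A⁺))) (vars* (W P)))
    vU : Tms Γ₁ (map (N ⇒_) (map (W A ⇛_) (W A⁺)))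
    vU = proj₂ (splitTms (W A₀) (map (N ⇒_) (map (W A ⇛_) (W A⁺))) (vars* (W P)))
    x0 : Tms Γ₁ ws
    x0 = castT (sym (W-sub (sub0S `0) A)) v₀
    Us : Tms Γ₁ (map (N ⇒_) (map (ws ⇛_) ws))
    Us = castT (cong (λ l → map (N ⇒_) (map (ws ⇛_) l)) (sym (W-sub sucS A))) vU
    open SimultaneousRecursion ws x0 Us
    premise : Fm Γ₁
    premise = HRs P σ₁ (vars* (W P))
    Xn : Tms (N ∷ Γ₁) ws
    Xn = appVar0 ws Xs
    claim : Fm (N ∷ Γ₁)
    claim = HRs A (extS σ₁) Xn
    claim-zero : premise ∷ [] ⊢ claim [ `0 ]
    claim-zero = cast⊢ (sym (trans (subF-HRs A (extS σ₁) (sub0S `0) Xn) (cong (HRs A _) (sub0-appVar0 ws Xs `0))))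
      (HRs-eq A (EqS-≡ (λ v → sym (extS-sub0-comm σ₁ `0 v))) (EqT-sym Xs-zero)
        (cast⊢ (HRs-subF (sub0S `0) A σ₁ v₀ x0 (TEq-sym (castT-TEq (sym (W-sub (sub0S `0) A)) v₀))) (∧E₁ (hyp (here refl)))))
    step : map wkF (premise ∷ []) ⊢ HRs (A ⇒ᶠ A⁺) (extS σ₁) (appVar0 _ vU)
    step = ∀unpack (∧E₂ (hyp (here refl)))
    Xn≡ : Xn ≡ appT ws (subTms wk1S Xs) (var here)
    Xn≡ = trans (appVar0-appT ws Xs) (cong (λ z → appT ws z (var here)) (renTms-sub there Xs))
    stepped : Tms (N ∷ Γ₁) ws
    stepped = appAll ws ws (appVar0 (map (ws ⇛_) ws) Us) Xn
    stepped≡ : stepped ≡ Step wk1S (var here) (appT ws (subTms wk1S Xs) (var here))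
    stepped≡ = cong₂ (appAll ws ws) (trans (appVar0-appT _ Us) (cong (λ z → appT _ z (var here)) (renTms-sub there Us))) Xn≡
    sucS-Xn≡ : subTms sucS Xn ≡ appT ws (subTms wk1S Xs) (`S · var here)
    sucS-Xn≡ = trans (cong (subTms sucS) (appVar0-appT ws Xs)) (trans (appT-sub ws sucS _ (var here))
      (cong (λ z → appT ws z (`S · var here)) (trans (subTms-renTms there sucS Xs) (subTms-cong (λ v → refl) Xs))))
    claim-suc : claim ∷ map wkF (premise ∷ []) ⊢ subF sucS claim
    claim-suc = cast⊢ (sym (trans (subF-HRs A (extS σ₁) sucS Xn) (cong (HRs A _) sucS-Xn≡)))
      (HRs-eq A (EqS-≡ (extS-sucS σ₁)) (EqT-trans (EqT-≡ stepped≡) (EqT-sym Xs-suc))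
        (cast⊢ (HRs-subF sucS A (extS σ₁) _ stepped (castT-step-TEq ws ws (W A⁺) (sym (W-sub sucS A)) vU Xn))
          (HRs-⇒E A A⁺ (extS σ₁) (appVar0 _ vU) Xn (wk1 step) (hyp (here refl)))))
    conclusion : premise ∷ [] ⊢ HRs Q σ₁ Xs
    conclusion = ⇒E (haax (ind claim)) (∧I claim-zero (∀I (⇒I claim-suc)))


module Soundness (T : Fm [] → Set) (T-∃free : ∀ B → T B → ExFree B) where
  open InductionAxiom T public

  HRs-∀E : ∀ {Γ Δ ρ} {H : List (Fm Δ)} (A : Fm (ρ ∷ Γ)) (σ : Sub Γ Δ) (Xs : Tms Δ (W (∀ᶠ ρ A))) (t : Tm Γ ρ)
         → H ⊢ HRs (∀ᶠ ρ A) σ Xs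
         → H ⊢ HRs (A [ t ]) σ (castT (W-sub (sub0S t) A) (subTms (sub0S (subT σ t)) (appVar0 (W A) Xs)))
  HRs-∀E A σ Xs t d =
    cast⊢ (trans (subF-HRs A (extS σ) (sub0S (subT σ t)) _)
            (trans (HRs-cong A (extS-sub0-comm σ t) ys) (sym (HRs-subF (sub0S t) A σ _ ys (castT-TEq (W-sub (sub0S t) A) ys)))))
      (∀E d (subT σ t))
    where
    ys = subTms (sub0S (subT σ t)) (appVar0 (W A) Xs)

  HRs-∃I-term : ∀ {Γ Δ ρ} {H : List (Fm Δ)} (A : Fm (ρ ∷ Γ)) (σ : Sub Γ Δ) (t : Tm Γ ρ) (a : Tms Δ (W (A [ t ])))
              → H ⊢ HRs (A [ t ]) σ a
              → H ⊢ HRs (∃ᶠ ρ A) σ ((`s ρ · subT σ t) ∷ₜ castT (sym (W-sub (sub0S t) A)) a)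
  HRs-∃I-term A σ t a d = ∃∈I _ (subT σ t) (s-mem _)
    (cast⊢ (trans (HRs-subF (sub0S t) A σ a xs (TEq-sym (castT-TEq (sym (W-sub (sub0S t) A)) a)))
             (sym (trans (subF-HRs A (extS σ) (sub0S (subT σ t)) _) (trans (cong (HRs A _) (sub0-wkTms _ xs)) (HRs-cong A (extS-sub0-comm σ t) xs)))))
      d)
    where
    xs = castT (sym (W-sub (sub0S t) A)) a

  -- The witnesses c for C depend on the element z of Z; all of them are collected by ⋃̂ over Z.
  HRs-∃E : ∀ {Γ Δ ρ} {H : List (Fm Δ)} (A : Fm (ρ ∷ Γ)) (C : Fm Γ) (σ : Sub Γ Δ) (Z : Tm Δ (ρ *)) (x : Tms Δ (W A))
           (c : Tms (ρ ∷ Δ) (W (wkF C)))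
              → H ⊢ HRs (∃ᶠ ρ A) σ (Z ∷ₜ x)
              → HRs A (extS σ) (renTms there x) ∷ map wkF H ⊢ HRs (wkF C) (extS σ) c
              → H ⊢ HRs C σ (⋃̂s (W C) Z (lams (W C) (castT (sym (W-ren there C)) c)))
  HRs-∃E {ρ = ρ} {H} A C σ Z x c d e = ∃∈E d (cast⊢ (sym (renF-HRs C σ there _))
      (HRs-mono C _ (⊑Tms-⋃-var0 (W C) Z (lams (W C) c') (hyp (here refl)))
        (HRs-eqT C (EqT-sym (appVar0-lams (W C) c')) (wk1 e'))))
    where
    c' : Tms (ρ ∷ _) (W C)
    c' = castT (sym (W-ren there C)) c
    e' : HRs A (extS σ) (renTms there x) ∷ map wkF H ⊢ HRs C (λ v → wkT (σ v)) c'
    e' = cast⊢ (HRs-renF there C (extS σ) c c' (TEq-sym (castT-TEq (sym (W-ren there C)) c))) e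

  ExFree-atomic : ∀ {Γ} {B : Fm Γ} → Atomic B → ExFree B
  ExFree-atomic at-⊥ = ef-⊥
  ExFree-atomic (at-≐ t q) = ef-≐ t q
  ExFree-atomic (at-∈ t q) = ef-∈ t q

  ExFree-axiom-realized : ∀ {Γ} {A : Fm Γ} → HATAx T A → ExFree A → Realized A
  ExFree-axiom-realized a e σ = ExFree-realized e σ (ax (HATAx-sub σ a))

  HAAx-realized : ∀ {Γ} {A : Fm Γ} → HAAx A → Realized A
  HAAx-realized (il (ball t A)) = ball-realized t A
  HAAx-realized (il (bex t A)) = bex-realized t A
  HAAx-realized (ind A) = ind-realized A
  HAAx-realized a@(il (eq-refl x)) = ExFree-axiom-realized (ha a) (ef-≐ _ _)
  HAAx-realized a@(il (eq-subst B at x y)) =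
    ExFree-axiom-realized (ha a) (ef-⇒ (ef-∧ (ef-≐ _ _) (ExFree-atomic (atomic-sub _ at))) (ExFree-atomic (atomic-sub _ at)))
  HAAx-realized a@(il (Σ-ax x y z)) = ExFree-axiom-realized (ha a) (ef-≐ _ _)
  HAAx-realized a@(il (Π-ax x y)) = ExFree-axiom-realized (ha a) (ef-≐ _ _)
  HAAx-realized a@(il (s-ax w x)) = ExFree-axiom-realized (ha a) (ef-∧ (ef-⇒ (ef-∈ _ _) (ef-≐ _ _)) (ef-⇒ (ef-≐ _ _) (ef-∈ _ _)))
  HAAx-realized a@(il (∪-ax w x y)) =
    ExFree-axiom-realized (ha a) (ef-∧ (ef-⇒ (ef-∈ _ _) (ef-∨ (ef-∈ _ _) (ef-∈ _ _))) (ef-⇒ (ef-∨ (ef-∈ _ _) (ef-∈ _ _)) (ef-∈ _ _)))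
  HAAx-realized a@(il (⋃-ax z x w y)) = ExFree-axiom-realized (ha a) (ef-⇒ (ef-∧ (ef-∈ _ _) (ef-∈ _ _)) (ef-∈ _ _))
  HAAx-realized a@(il (⋃s-ax x y)) = ExFree-axiom-realized (ha a) (ef-≐ _ _)
  HAAx-realized a@(il (⋃∪-ax x y z)) = ExFree-axiom-realized (ha a) (ef-≐ _ _)
  HAAx-realized a@(S≠0 x) = ExFree-axiom-realized (ha a) (ef-⇒ (ef-≐ _ _) ef-⊥)
  HAAx-realized a@(S-inj x y) = ExFree-axiom-realized (ha a) (ef-⇒ (ef-≐ _ _) (ef-≐ _ _))
  HAAx-realized a@(R0 y z) = ExFree-axiom-realized (ha a) (ef-≐ _ _)
  HAAx-realized a@(RS x y z) = ExFree-axiom-realized (ha a) (ef-≐ _ _)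

  FullAx-realized : ∀ {Γ} {A : Fm Γ} → FullAx T A → Realized A
  FullAx-realized (ha a) = HAAx-realized a
  FullAx-realized (ac ρ κ A) = AC-realized ρ κ A
  FullAx-realized (ip κ B e A) = IP-realized κ B e A
  FullAx-realized (thy B tB) = ExFree-axiom-realized (thy B tB) (ExFree-ren _ (T-∃free B tB))

  sound : ∀ {Γ Δ A} → Der (FullAx T) Γ Δ A → ∀ {Γ'} (σ : Sub Γ Γ') (ds : HypWitnesses Δ Γ')
        → Σ (Tms Γ' (W A)) (λ a → HRsHyps Δ σ ds ⊢ HRs A σ a)
  sound (hyp p) σ ds with HRsHyps-∈ p σ ds
  ... | a , q = a , hyp q
  sound (ax x) σ ds with FullAx-realized x σ
  ... | a , d = a , weakD (λ ()) d
  sound (⊥E A d) σ ds with sound d σ ds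
  ... | _ , e = defaultTms (W A) , ⊥E _ e
  sound (∧I {A = A} {B} d d₁) σ ds with sound d σ ds | sound d₁ σ ds
  ... | a , e | b , f = a ++ₜ b , HRs-∧I A B σ a b e f
  sound (∧E₁ {A = A} {B} d) σ ds with sound d σ ds
  ... | a , e = proj₁ (splitTms (W A) (W B) a) , ∧E₁ e
  sound (∧E₂ {A = A} {B} d) σ ds with sound d σ ds
  ... | a , e = proj₂ (splitTms (W A) (W B) a) , ∧E₂ e
  sound (∨I₁ {A = A} B d) σ ds with sound d σ ds
  ... | a , e = a ++ₜ defaultTms (W B) , HRs-∨I₁ A B σ a e
  sound (∨I₂ {B = B} A d) σ ds with sound d σ ds
  ... | b , e = defaultTms (W A) ++ₜ b , HRs-∨I₂ A B σ b e
  sound (∨E {A = A} {B} {C} d d₁ d₂) σ ds with sound d σ ds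
  ... | a , e with sound d₁ σ (proj₁ (splitTms (W A) (W B) a) , ds) | sound d₂ σ (proj₂ (splitTms (W A) (W B) a) , ds)
  ... | c₁ , e₁ | c₂ , e₂ =
    ∪̂s (W C) c₁ c₂ , ∨E e (HRs-mono C σ (⊑Tms-∪L (W C) c₁ c₂) e₁) (HRs-mono C σ (⊑Tms-∪R (W C) c₁ c₂) e₂)
  sound (⇒I {Δ = Δ} {A} {B} d) σ ds with sound d (wkS* (W A) σ) (vars* (W A) , renHypWitnesses Δ (wk* (W A)) ds)
  ... | b , e = lams* (W A) (W B) b , HRs-⇒I A B σ b (castH (cong (_ ∷_) (HRsHyps-ren Δ σ (wk* (W A)) ds)) e)
  sound (⇒E {A = A} {B} d d₁) σ ds with sound d σ ds | sound d₁ σ ds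
  ... | U , e | a , f = appAll (W A) (W B) U a , HRs-⇒E A B σ U a e f
  sound (∀I {Δ = Δ} {A = A} d) σ ds with sound d (extS σ) (wkHypWitnesses Δ ds)
  ... | a , e = lams (W A) a , ∀I (HRs-eqT A (EqT-sym (appVar0-lams (W A) a)) (castH (HRsHyps-wk Δ σ ds) e))
  sound (∀E {A = A} d t) σ ds with sound d σ ds
  ... | Xs , e = _ , HRs-∀E A σ Xs t e
  sound (∃I {ρ = ρ} A t d) σ ds with sound d σ ds
  ... | a , e = (`s ρ · subT σ t) ∷ₜ castT (sym (W-sub (sub0S t) A)) a , HRs-∃I-term A σ t a e
  sound (∃E {Δ = Δ} {A = A} {C} d d₁) σ ds with sound d σ ds
  ... | Z ∷ₜ x , e with sound d₁ (extS σ) (renTms there x , wkHypWitnesses Δ ds)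
  ... | c , e' = _ , HRs-∃E A C σ Z x c e (castH (cong (_ ∷_) (HRsHyps-wk Δ σ ds)) e')


theorem12 : (T : Fm [] → Set) → (∀ B → T B → ExFree B)
          → (Γ : Ctx) (A : Fm Γ)
          → Γ ∣ [] ⊢[ FullAx T ] A
          → Σ (Tms [] (map (Γ ⇛ᶜ_) (W A)))
              (λ ts → Γ ∣ [] ⊢[ HATAx T ] HR A (appCtxs Γ (W A) ts))
theorem12 T T-∃free Γ A d =
  let open Soundness T T-∃free
      (a , ⊢a) = sound d var tt
  in lamCs Γ (W A) a , HRs-eqT A (EqT-sym (appCtxs-lamCs Γ (W A) a)) ⊢a
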